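{- Let $\mathfrak Q,\mathfrak Q'$ be quasigroups and $\theta:L_0(\mathfrak QK_3)\hookrightarrow L_0(\mathfrak Q'K_3)$ a matroid monomorphism. If $\#\mathfrak Q>2$, then $\theta$ induces a biased-graph monomorphism $\theta'':\langle\mathfrak QK_3\rangle\hookrightarrow\langle\mathfrak Q'K_3\rangle$. If $\#\mathfrak Q\le2$, there is a biased-graph monomorphism $\langle\mathfrak QK_3\rangle\hookrightarrow\langle\mathfrak Q'K_3\rangle$, though not necessarily one induced by $\theta$.
   Context: For a quasigroup $(\mathfrak Q,\cdot)$, $\langle\mathfrak QK_3\rangle$ is the biased graph with nodes $v_1,v_2,v_3$, links $ge_{ij}$ ($g\in\mathfrak Q$, $ij\in\{12,23,13\}$) joining $v_i,v_j$, and balanced circles exactly the triangles $\{ge_{12},he_{23},ke_{13}\}$ with $g\cdot h=k$. The extended lift matroid $L_0(\mathfrak QK_3)$ has ground set $E(\mathfrak QK_3)\cup\{e_0\}$ ($e_0$ an extra element) and rank $\operatorname{rk}S=3-c(S)$ if $S\subseteq E$ is balanced (all its circles balanced), and $3-c(S\setminus\{e_0\})+1$ otherwise, where $c(T)$ is the number of connected components of $(\{v_1,v_2,v_3\},T)$. A matroid monomorphism is an injective map between ground sets preserving the rank of every subset. A biased-graph monomorphism is an injective map on nodes and edges preserving incidence that maps balanced circles to balanced circles and unbalanced circles to unbalanced circles; "$\theta$ induces $\theta''$" means $\theta''$ agrees with $\theta$ on the edges. -}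

module Defs where

open import Data.Nat using (ℕ; _+_)
open import Data.Fin using (Fin; zero; suc)
open import Data.Maybe using (Maybe; just; nothing)
open import Data.Product using (Σ; ∃; ∃-syntax; _×_; _,_)
open import Data.Sum using (_⊎_)
open import Data.Empty using (⊥)
open import Relation.Nullary using (¬_)
open import Relation.Binary.PropositionalEquality using (_≡_; _≢_)
open import Function.Definitions using (Injective; Surjective)
open import Algebra.Core using (Op₂)
import Algebra.Structures as AS

record Quasigroup : Set₁ where
  infixl 7 _·_
  field
    Carrier      : Set
    _·_          : Op₂ Carrier
    _\\_         : Op₂ Carrier
    _//_         : Op₂ Carrier
    isQuasigroup : AS.IsQuasigroup {A = Carrier} _≡_ _·_ _\\_ _//_

open Quasigroup public

CardGt2 : Quasigroup → Set
CardGt2 Q = Σ (Carrier Q) λ a → Σ (Carrier Q) λ b → Σ (Carrier Q) λ c → (a ≢ b × b ≢ c × a ≢ c)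

CardLe2 : Quasigroup → Set
CardLe2 Q = ∀ (a b c : Carrier Q) → a ≡ b ⊎ b ≡ c ⊎ a ≡ c

Pred : Set → Set₁
Pred A = A → Set

_⊆_ : {A : Set} → Pred A → Pred A → Set
S ⊆ T = ∀ x → S x → T x

_≐_ : {A : Set} → Pred A → Pred A → Set
S ≐ T = S ⊆ T × T ⊆ S

img : {A B : Set} → (A → B) → Pred A → Pred B
img f S y = ∃[ x ] (S x × f x ≡ y)

data Pair : Set where
  e12 e23 e13 : Pair

Node : Set
Node = Fin 3

v₁ v₂ v₃ : Node
v₁ = zero
v₂ = suc zero
v₃ = suc (suc zero)

-- the link g e_ij is represented as (ij , g)
Edge : Quasigroup → Set
Edge Q = Pair × Carrier Q

pairOf : {Q : Quasigroup} → Edge Q → Pair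
pairOf (p , _) = p

Joins : Pair → Node → Node → Set
Joins e12 u v = (u ≡ v₁ × v ≡ v₂) ⊎ (u ≡ v₂ × v ≡ v₁)
Joins e23 u v = (u ≡ v₂ × v ≡ v₃) ⊎ (u ≡ v₃ × v ≡ v₂)
Joins e13 u v = (u ≡ v₁ × v ≡ v₃) ⊎ (u ≡ v₃ × v ≡ v₁)

pair⟨_,_⟩ : {A : Set} → A → A → Pred A
pair⟨ x , y ⟩ z = z ≡ x ⊎ z ≡ y

triple⟨_,_,_⟩ : {A : Set} → A → A → A → Pred A
triple⟨ x , y , z ⟩ w = w ≡ x ⊎ w ≡ y ⊎ w ≡ z

IsCircle : (Q : Quasigroup) → Pred (Edge Q) → Set
IsCircle Q T =
    (∃[ p ] ∃[ g ] ∃[ h ] (g ≢ h × T ≐ pair⟨ (p , g) , (p , h) ⟩))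
  ⊎ (∃[ g ] ∃[ h ] ∃[ k ] (T ≐ triple⟨ (e12 , g) , (e23 , h) , (e13 , k) ⟩))

IsBalancedCircle : (Q : Quasigroup) → Pred (Edge Q) → Set
IsBalancedCircle Q T =
  ∃[ g ] ∃[ h ] ∃[ k ] (_·_ Q g h ≡ k × T ≐ triple⟨ (e12 , g) , (e23 , h) , (e13 , k) ⟩)

IsUnbalancedCircle : (Q : Quasigroup) → Pred (Edge Q) → Set
IsUnbalancedCircle Q T = IsCircle Q T × ¬ IsBalancedCircle Q T

Balanced : (Q : Quasigroup) → Pred (Edge Q) → Set₁
Balanced Q S = ∀ T → T ⊆ S → IsCircle Q T → IsBalancedCircle Q T

Adj : {Q : Quasigroup} → Pred (Edge Q) → Node → Node → Set
Adj {Q} T u v = ∃[ e ] (T e × Joins (pairOf {Q} e) u v)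

data Conn {Q : Quasigroup} (T : Pred (Edge Q)) : Node → Node → Set where
  here : ∀ {u} → Conn T u u
  step : ∀ {u v w} → Adj {Q} T u v → Conn {Q} T v w → Conn {Q} T u w

-- c(T) = k : there is a labelling of the nodes by k labels, all used,
-- such that two nodes get the same label iff they are connected.
NumComponents : {Q : Quasigroup} → Pred (Edge Q) → ℕ → Set
NumComponents {Q} T k =
  Σ (Node → Fin k) λ f →
    Surjective _≡_ _≡_ f × (∀ u v → (f u ≡ f v → Conn {Q} T u v) × (Conn {Q} T u v → f u ≡ f v))

-- The extended lift matroid L₀(Q K₃): ground set E ∪ {e₀},
-- represented as Maybe (Edge Q) with e₀ = nothing.

L0Elem : Quasigroup → Set
L0Elem Q = Maybe (Edge Q)

e₀ : {Q : Quasigroup} → L0Elem Q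
e₀ = nothing

edgesOf : {Q : Quasigroup} → Pred (L0Elem Q) → Pred (Edge Q)
edgesOf S e = S (just e)

RankIs : (Q : Quasigroup) → Pred (L0Elem Q) → ℕ → Set₁
RankIs Q S r =
    (¬ S (e₀ {Q}) × Balanced Q (edgesOf {Q} S) × ∃[ k ] (NumComponents {Q} (edgesOf {Q} S) k × r + k ≡ 3))
  ⊎ ((S (e₀ {Q}) ⊎ ¬ Balanced Q (edgesOf {Q} S)) × ∃[ k ] (NumComponents {Q} (edgesOf {Q} S) k × r + k ≡ 4))

IsMatroidMono : (Q Q' : Quasigroup) → (L0Elem Q → L0Elem Q') → Set₁
IsMatroidMono Q Q' θ =
  Injective _≡_ _≡_ θ ×
  (∀ (S : Pred (L0Elem Q)) (r : ℕ) → (RankIs Q S r → RankIs Q' (img θ S) r)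
                                    × (RankIs Q' (img θ S) r → RankIs Q S r))

IsBiasedGraphMono : (Q Q' : Quasigroup) → (Node → Node) → (Edge Q → Edge Q') → Set₁
IsBiasedGraphMono Q Q' φ ψ =
  Injective _≡_ _≡_ φ ×
  Injective _≡_ _≡_ ψ ×
  (∀ e u v → Joins (pairOf {Q} e) u v → Joins (pairOf {Q'} (ψ e)) (φ u) (φ v)) ×
  (∀ T → IsBalancedCircle Q T → IsBalancedCircle Q' (img ψ T)) ×
  (∀ T → IsUnbalancedCircle Q T → IsUnbalancedCircle Q' (img ψ T))

BiasedGraphMono : (Q Q' : Quasigroup) → Set₁
BiasedGraphMono Q Q' = Σ (Node → Node) λ φ → Σ (Edge Q → Edge Q') λ ψ → IsBiasedGraphMono Q Q' φ ψ

Induces : (Q Q' : Quasigroup) → (L0Elem Q → L0Elem Q') → BiasedGraphMono Q Q' → Set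
Induces Q Q' θ (φ , ψ , _) = ∀ (e : Edge Q) → θ (just e) ≡ just (ψ e)

module Submission where

-- MatroidMono shows that θ fixes e₀ when #Q > 2; then the restriction of θ
-- to links is such a map, induced by θ.  For #Q ≤ 2 either θ still fixes
-- e₀, and the restriction works after normalising its class permutation
-- elementwise, or θ e₀ is a link P, and ThroughLink reads an isotopic copy of
-- Q inside Q' off the configuration of the images around P.  The proposition
-- at the end combines these three cases.

open import Defs
open import Data.Product using (Σ; _×_; _,_; proj₁; proj₂)
open import Data.Sum using (_⊎_; inj₁; inj₂)
open import Data.Empty using (⊥; ⊥-elim)
open import Data.Nat using (ℕ; _≤_)
import Data.Nat.Properties as NP
open import Data.Fin using (Fin; zero; suc)
import Data.Fin.Properties as FP
open import Data.Maybe using (Maybe; just; nothing)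
open import Data.Maybe.Properties using (just-injective)
open import Relation.Nullary using (¬_; Dec; yes; no)
open import Relation.Binary.PropositionalEquality
open import Function using (_∘_)
open import Function.Definitions using (Injective; Surjective)
import Algebra.Structures as AS
import Algebra.Bundles as Bundles
import Algebra.Properties.Quasigroup as QuasigroupProperties

_≟P_ : (p q : Pair) → Dec (p ≡ q)
e12 ≟P e12 = yes refl
e12 ≟P e23 = no λ ()
e12 ≟P e13 = no λ ()
e23 ≟P e12 = no λ ()
e23 ≟P e23 = yes refl
e23 ≟P e13 = no λ ()
e13 ≟P e12 = no λ ()
e13 ≟P e23 = no λ ()
e13 ≟P e13 = yes refl

Distinct3 : Pair → Pair → Pair → Set
Distinct3 a b c = a ≢ b × b ≢ c × a ≢ c

-- Perm3 a b c: the list a , b , c enumerates the three classes.  Matching on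
-- this view replaces case analyses over all 27 triples of classes.
data Perm3 : Pair → Pair → Pair → Set where
  p123 : Perm3 e12 e23 e13
  p132 : Perm3 e12 e13 e23
  p213 : Perm3 e23 e12 e13
  p231 : Perm3 e23 e13 e12
  p312 : Perm3 e13 e12 e23
  p321 : Perm3 e13 e23 e12

perm3 : ∀ {a b c} → Distinct3 a b c → Perm3 a b c
perm3 {e12} {e23} {e13} _ = p123
perm3 {e12} {e13} {e23} _ = p132
perm3 {e23} {e12} {e13} _ = p213
perm3 {e23} {e13} {e12} _ = p231
perm3 {e13} {e12} {e23} _ = p312
perm3 {e13} {e23} {e12} _ = p321
perm3 {e12} {e12} (ab , _) = ⊥-elim (ab refl)
perm3 {e23} {e23} (ab , _) = ⊥-elim (ab refl)
perm3 {e13} {e13} (ab , _) = ⊥-elim (ab refl)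
perm3 {_} {e12} {e12} (_ , bc , _) = ⊥-elim (bc refl)
perm3 {_} {e23} {e23} (_ , bc , _) = ⊥-elim (bc refl)
perm3 {_} {e13} {e13} (_ , bc , _) = ⊥-elim (bc refl)
perm3 {e12} {_} {e12} (_ , _ , ac) = ⊥-elim (ac refl)
perm3 {e23} {_} {e23} (_ , _ , ac) = ⊥-elim (ac refl)
perm3 {e13} {_} {e13} (_ , _ , ac) = ⊥-elim (ac refl)

perm3-distinct : ∀ {a b c} → Perm3 a b c → Distinct3 a b c
perm3-distinct p123 = (λ ()) , (λ ()) , (λ ())
perm3-distinct p132 = (λ ()) , (λ ()) , (λ ())
perm3-distinct p213 = (λ ()) , (λ ()) , (λ ())
perm3-distinct p231 = (λ ()) , (λ ()) , (λ ())
perm3-distinct p312 = (λ ()) , (λ ()) , (λ ())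
perm3-distinct p321 = (λ ()) , (λ ()) , (λ ())

distinct-swap₁₂ : ∀ {a b c} → Distinct3 a b c → Distinct3 b a c
distinct-swap₁₂ (ab , bc , ac) = (λ e → ab (sym e)) , (λ e → ac e) , bc

distinct-swap₂₃ : ∀ {a b c} → Distinct3 a b c → Distinct3 a c b
distinct-swap₂₃ (ab , bc , ac) = ac , (λ e → bc (sym e)) , ab

third : Pair → Pair → Pair
third e12 e23 = e13
third e23 e12 = e13
third e12 e13 = e23
third e13 e12 = e23
third e23 e13 = e12
third e13 e23 = e12
third a _ = a

third-perm : ∀ {a b} → a ≢ b → Perm3 a b (third a b)
third-perm {e12} {e23} _ = p123
third-perm {e23} {e12} _ = p213
third-perm {e12} {e13} _ = p132
third-perm {e13} {e12} _ = p312
third-perm {e23} {e13} _ = p231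
third-perm {e13} {e23} _ = p321
third-perm {e12} {e12} ab = ⊥-elim (ab refl)
third-perm {e23} {e23} ab = ⊥-elim (ab refl)
third-perm {e13} {e13} ab = ⊥-elim (ab refl)

perm3-unique : ∀ {a b c d} → Perm3 a b c → Perm3 a b d → c ≡ d
perm3-unique p123 p123 = refl
perm3-unique p132 p132 = refl
perm3-unique p213 p213 = refl
perm3-unique p231 p231 = refl
perm3-unique p312 p312 = refl
perm3-unique p321 p321 = refl

third-unique : ∀ {a b c} → Distinct3 a b c → c ≡ third a b
third-unique d = perm3-unique (perm3 d) (third-perm (proj₁ d))

third-distinct : ∀ {a b} → a ≢ b → Distinct3 a b (third a b)
third-distinct ab = perm3-distinct (third-perm ab)

third-≢ˡ : ∀ {a b} → a ≢ b → third a b ≢ a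
third-≢ˡ ab = ≢-sym (proj₂ (proj₂ (third-distinct ab)))

third-≢ʳ : ∀ {a b} → a ≢ b → third a b ≢ b
third-≢ʳ ab = ≢-sym (proj₁ (proj₂ (third-distinct ab)))

third-involutive : ∀ {a b} → a ≢ b → third a (third a b) ≡ b
third-involutive ab = sym (third-unique (≢-sym (third-≢ˡ ab) , third-≢ʳ ab , ab))

third-injective : ∀ {a b b'} → a ≢ b → a ≢ b' → third a b ≡ third a b' → b ≡ b'
third-injective {a} ab ab' e = trans (sym (third-involutive ab)) (trans (cong (third a) e) (third-involutive ab'))

perm3-cover : ∀ {a b c} → Distinct3 a b c → ∀ q → q ≡ a ⊎ q ≡ b ⊎ q ≡ c
perm3-cover {a} {b} d q with q ≟P a | q ≟P b
... | yes qa | _ = inj₁ qa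
... | no _ | yes qb = inj₂ (inj₁ qb)
... | no qa | no qb = inj₂ (inj₂ (sym (trans (third-unique d) (sym (third-unique (proj₁ d , (λ e → qb (sym e)) , (λ e → qa (sym e))))))))

select : Pair → Pair → Pair → Pair → Pair
select a b c e12 = a
select a b c e23 = b
select a b c e13 = c

position : Pair → Pair → Pair → Pair → Pair
position a b c p with a ≟P p | b ≟P p
... | yes _ | _ = e12
... | no _ | yes _ = e23
... | no _ | no _ = e13

select-position : ∀ {a b c} → Distinct3 a b c → ∀ p → select a b c (position a b c p) ≡ p
select-position {a} {b} {c} d p with a ≟P p | b ≟P p
... | yes e | _ = e
... | no _ | yes e = e
... | no ap | no bp with perm3-cover d p
...   | inj₁ e = ⊥-elim (ap (sym e))
...   | inj₂ (inj₁ e) = ⊥-elim (bp (sym e))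
...   | inj₂ (inj₂ e) = sym e

position-injective : ∀ {a b c} → Distinct3 a b c → Injective _≡_ _≡_ (position a b c)
position-injective {a} {b} {c} d {p} {q} e =
  trans (sym (select-position d p)) (trans (cong (select a b c) e) (select-position d q))

position-perm : ∀ {a b c} → Distinct3 a b c → Perm3 (position a b c e12) (position a b c e23) (position a b c e13)
position-perm d with perm3-distinct p123
... | n₁ , n₂ , n₃ = perm3 ((λ e → n₁ (position-injective d e)) , (λ e → n₂ (position-injective d e)) , (λ e → n₃ (position-injective d e)))

no-fourth-class : ∀ {a b c p} → Distinct3 a b c → a ≢ p → b ≢ p → c ≢ p → ⊥
no-fourth-class d ap bp cp with perm3-cover d _
... | inj₁ e = ap (sym e)
... | inj₂ (inj₁ e) = bp (sym e)
... | inj₂ (inj₂ e) = cp (sym e)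

perm3-rest : ∀ {z w₁ w₂ u v} → Perm3 z w₁ w₂ → Perm3 z u v → (w₁ ≡ u × w₂ ≡ v) ⊎ (w₁ ≡ v × w₂ ≡ u)
perm3-rest {w₁ = w₁} π ρ with perm3-cover (perm3-distinct ρ) w₁
... | inj₁ refl = ⊥-elim (proj₁ (perm3-distinct π) refl)
... | inj₂ (inj₁ refl) = inj₁ (refl , perm3-unique π ρ)
... | inj₂ (inj₂ refl) = inj₂ (refl , perm3-unique π (perm3 (distinct-swap₂₃ (perm3-distinct ρ))))

assign : {A : Set} → Pair → Pair → A → A → A → Pair → A
assign a b x y z q with q ≟P a | q ≟P b
... | yes _ | _ = x
... | no _ | yes _ = y
... | no _ | no _ = z

assign-first : ∀ {A : Set} a b {x y z : A} → assign a b x y z a ≡ x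
assign-first a b with a ≟P a
... | yes _ = refl
... | no n = ⊥-elim (n refl)

assign-values : ∀ {A : Set} {a b c} {x y z : A} → Distinct3 a b c →
  assign a b x y z a ≡ x × assign a b x y z b ≡ y × assign a b x y z c ≡ z
assign-values {a = a} {b} {c} (ab , bc , ac) = assign-first a b , at-b , at-c
  where
  at-b : assign a b _ _ _ b ≡ _
  at-b with b ≟P a | b ≟P b
  ... | yes e | _ = ⊥-elim (ab (sym e))
  ... | no _ | yes _ = refl
  ... | no _ | no n = ⊥-elim (n refl)
  at-c : assign a b _ _ _ c ≡ _
  at-c with c ≟P a | c ≟P b
  ... | yes e | _ = ⊥-elim (ac (sym e))
  ... | no _ | yes e = ⊥-elim (bc (sym e))
  ... | no _ | no _ = refl

next : Pair → Pair
next e12 = e23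
next e23 = e13
next e13 = e12

next-perm : ∀ r → Perm3 r (next r) (next (next r))
next-perm e12 = p123
next-perm e23 = p231
next-perm e13 = p312

-- Nodes versus classes: the class e_ij is opposite to the node v_k, k ∉ {i,j}.

apex : Pair → Node
apex e12 = v₃
apex e23 = v₁
apex e13 = v₂

side : Node → Pair
side zero = e23
side (suc zero) = e13
side (suc (suc zero)) = e12

apex-side : ∀ u → apex (side u) ≡ u
apex-side zero = refl
apex-side (suc zero) = refl
apex-side (suc (suc zero)) = refl

side-apex : ∀ p → side (apex p) ≡ p
side-apex e12 = refl
side-apex e23 = refl
side-apex e13 = refl

side-injective : ∀ {u v} → side u ≡ side v → u ≡ v
side-injective {u} {v} e = trans (sym (apex-side u)) (trans (cong apex e) (apex-side v))

apex-injective : ∀ {p q} → apex p ≡ apex q → p ≡ q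
apex-injective {p} {q} e = trans (sym (side-apex p)) (trans (cong side e) (side-apex q))

joins-apex : ∀ {a b c} → Perm3 a b c → Joins a (apex b) (apex c)
joins-apex p123 = inj₁ (refl , refl)
joins-apex p132 = inj₂ (refl , refl)
joins-apex p213 = inj₂ (refl , refl)
joins-apex p231 = inj₁ (refl , refl)
joins-apex p312 = inj₂ (refl , refl)
joins-apex p321 = inj₁ (refl , refl)

joins-sides : ∀ p {u v} → Joins p u v → Perm3 p (side u) (side v)
joins-sides e12 (inj₁ (refl , refl)) = p123
joins-sides e12 (inj₂ (refl , refl)) = p132
joins-sides e23 (inj₁ (refl , refl)) = p231
joins-sides e23 (inj₂ (refl , refl)) = p213
joins-sides e13 (inj₁ (refl , refl)) = p321
joins-sides e13 (inj₂ (refl , refl)) = p312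

joins-sym : ∀ p {u v} → Joins p u v → Joins p v u
joins-sym e12 (inj₁ (a , b)) = inj₂ (b , a)
joins-sym e12 (inj₂ (a , b)) = inj₁ (b , a)
joins-sym e23 (inj₁ (a , b)) = inj₂ (b , a)
joins-sym e23 (inj₂ (a , b)) = inj₁ (b , a)
joins-sym e13 (inj₁ (a , b)) = inj₂ (b , a)
joins-sym e13 (inj₂ (a , b)) = inj₁ (b , a)

≐-refl : {A : Set} {S : Pred A} → S ≐ S
≐-refl = (λ _ s → s) , (λ _ s → s)

≐-sym : {A : Set} {S T : Pred A} → S ≐ T → T ≐ S
≐-sym (a , b) = b , a

≐-trans : {A : Set} {S T U : Pred A} → S ≐ T → T ≐ U → S ≐ U
≐-trans (a , b) (c , d) = (λ x s → c x (a x s)) , (λ x u → b x (d x u))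

module _ {A : Set} {x y z : A} where
  t132 : triple⟨ x , y , z ⟩ ≐ triple⟨ x , z , y ⟩
  t132 = swap , swap
    where
    swap : ∀ {a b c : A} → triple⟨ a , b , c ⟩ ⊆ triple⟨ a , c , b ⟩
    swap _ (inj₁ e) = inj₁ e
    swap _ (inj₂ (inj₁ e)) = inj₂ (inj₂ e)
    swap _ (inj₂ (inj₂ e)) = inj₂ (inj₁ e)

  t213 : triple⟨ x , y , z ⟩ ≐ triple⟨ y , x , z ⟩
  t213 = swap , swap
    where
    swap : ∀ {a b c : A} → triple⟨ a , b , c ⟩ ⊆ triple⟨ b , a , c ⟩
    swap _ (inj₁ e) = inj₂ (inj₁ e)
    swap _ (inj₂ (inj₁ e)) = inj₁ e
    swap _ (inj₂ (inj₂ e)) = inj₂ (inj₂ e)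

t231 : {A : Set} {x y z : A} → triple⟨ x , y , z ⟩ ≐ triple⟨ y , z , x ⟩
t231 = ≐-trans t213 t132

t312 : {A : Set} {x y z : A} → triple⟨ x , y , z ⟩ ≐ triple⟨ z , x , y ⟩
t312 = ≐-trans t132 t213

t321 : {A : Set} {x y z : A} → triple⟨ x , y , z ⟩ ≐ triple⟨ z , y , x ⟩
t321 = ≐-trans t132 (≐-trans t213 t132)

img-triple : {A B : Set} (f : A → B) {x y z : A} → img f triple⟨ x , y , z ⟩ ≐ triple⟨ f x , f y , f z ⟩
img-triple f {x} {y} {z} = to , from
  where
  to : img f triple⟨ x , y , z ⟩ ⊆ triple⟨ f x , f y , f z ⟩
  to _ (_ , inj₁ refl , refl) = inj₁ refl
  to _ (_ , inj₂ (inj₁ refl) , refl) = inj₂ (inj₁ refl)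
  to _ (_ , inj₂ (inj₂ refl) , refl) = inj₂ (inj₂ refl)
  from : triple⟨ f x , f y , f z ⟩ ⊆ img f triple⟨ x , y , z ⟩
  from _ (inj₁ refl) = x , inj₁ refl , refl
  from _ (inj₂ (inj₁ refl)) = y , inj₂ (inj₁ refl) , refl
  from _ (inj₂ (inj₂ refl)) = z , inj₂ (inj₂ refl) , refl

img-pair : {A B : Set} (f : A → B) {x y : A} → img f pair⟨ x , y ⟩ ≐ pair⟨ f x , f y ⟩
img-pair f {x} {y} = to , from
  where
  to : img f pair⟨ x , y ⟩ ⊆ pair⟨ f x , f y ⟩
  to _ (_ , inj₁ refl , refl) = inj₁ refl
  to _ (_ , inj₂ refl , refl) = inj₂ refl
  from : pair⟨ f x , f y ⟩ ⊆ img f pair⟨ x , y ⟩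
  from _ (inj₁ refl) = x , inj₁ refl , refl
  from _ (inj₂ refl) = y , inj₂ refl , refl

img-≐ : {A B : Set} (f : A → B) {S T : Pred A} → S ≐ T → img f S ≐ img f T
img-≐ f (a , b) = (λ _ → λ { (x , s , e) → x , a x s , e }) , (λ _ → λ { (x , s , e) → x , b x s , e })

module _ {X : Quasigroup} where

  conn-trans : {T : Pred (Edge X)} {u v w : Node} → Conn {X} T u v → Conn {X} T v w → Conn {X} T u w
  conn-trans here c = c
  conn-trans (step a c) d = step a (conn-trans c d)

  conn-sym : {T : Pred (Edge X)} {u v : Node} → Conn {X} T u v → Conn {X} T v u
  conn-sym here = here
  conn-sym (step (e , te , j) c) = conn-trans (conn-sym c) (step (e , te , joins-sym (pairOf {X} e) j) here)

  conn-⊆ : {T T' : Pred (Edge X)} {u v : Node} → T ⊆ T' → Conn {X} T u v → Conn {X} T' u v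
  conn-⊆ s here = here
  conn-⊆ s (step (e , te , j) c) = step (e , s e te , j) (conn-⊆ s c)

  conn-label : {T : Pred (Edge X)} {k : ℕ} (f : Node → Fin k) →
    (∀ e u v → T e → Joins (pairOf {X} e) u v → f u ≡ f v) →
    ∀ {u v} → Conn {X} T u v → f u ≡ f v
  conn-label f h here = refl
  conn-label f h (step (e , te , j) c) = trans (h e _ _ te j) (conn-label f h c)

  nc-≐ : {T T' : Pred (Edge X)} {k : ℕ} → T ≐ T' → NumComponents {X} T k → NumComponents {X} T' k
  nc-≐ (a , b) (f , sf , hf) =
    f , sf , λ u v → (λ e → conn-⊆ a (proj₁ (hf u v) e)) , (λ c → proj₂ (hf u v) (conn-⊆ b c))

  -- two component labellings induce an injection Fin m → Fin n, and conversely
  nc-unique : {T : Pred (Edge X)} {k k' : ℕ} → NumComponents {X} T k → NumComponents {X} T k' → k ≡ k'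
  nc-unique {T} n₁ n₂ = NP.≤-antisym (labels-≤ n₁ n₂) (labels-≤ n₂ n₁)
    where
    labels-≤ : ∀ {m n} → NumComponents {X} T m → NumComponents {X} T n → m ≤ n
    labels-≤ (f , sf , hf) (g , sg , hg) = FP.injective⇒≤ {f = λ i → g (proj₁ (sf i))} inj
      where
      inj : Injective _≡_ _≡_ (λ i → g (proj₁ (sf i)))
      inj {i} {j} e = trans (sym (proj₂ (sf i) refl))
                       (trans (proj₂ (hf _ _) (proj₁ (hg _ _) e)) (proj₂ (sf j) refl))

  nc-one : {T : Pred (Edge X)} → (∀ u v → Conn {X} T u v) → NumComponents {X} T 1
  nc-one c = (λ _ → zero) , (λ { zero → v₁ , λ _ → refl }) , λ u v → (λ _ → c u v) , (λ _ → refl)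

  link-conn : {T : Pred (Edge X)} {p b c : Pair} {g : Carrier X} → T (p , g) → Perm3 p b c → Conn {X} T (apex b) (apex c)
  link-conn t π = step (_ , t , joins-apex π) here

  -- links of two different classes p, q connect all three nodes: every node is
  -- the apex of p, q or third p q, and both links reach apex (third p q)
  connected : {T : Pred (Edge X)} {p q : Pair} {g h : Carrier X} →
    T (p , g) → T (q , h) → p ≢ q → ∀ u v → Conn {X} T u v
  connected {T} {p} {q} tp tq pq u v = conn-trans (to-r u) (conn-sym (to-r v))
    where
    r = third p q
    π : Perm3 p q r
    π = third-perm pq
    to-r : ∀ u → Conn {X} T u (apex r)
    to-r u with perm3-cover (perm3-distinct π) (side u)
    ... | inj₁ e = subst (λ w → Conn {X} T w (apex r)) (trans (cong apex (sym e)) (apex-side u))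
                     (link-conn tq (perm3 (distinct-swap₁₂ (perm3-distinct π))))
    ... | inj₂ (inj₁ e) = subst (λ w → Conn {X} T w (apex r)) (trans (cong apex (sym e)) (apex-side u)) (link-conn tp π)
    ... | inj₂ (inj₂ e) = subst (λ w → Conn {X} T w (apex r)) (trans (cong apex (sym e)) (apex-side u)) here

  -- the apex of p versus the rest: the components of a set of links of class p
  apexLabel : Pair → Node → Fin 2
  apexLabel p u with side u ≟P p
  ... | yes _ = suc zero
  ... | no _ = zero

  nc-two : {T : Pred (Edge X)} {p : Pair} {g : Carrier X} → T (p , g) → (∀ e → T e → pairOf {X} e ≡ p) → NumComponents {X} T 2
  nc-two {T} {p} tp classP = apexLabel p , surj , λ u v → sameLabel u v , conn-label (apexLabel p) alongEdge
    where
    off-apex : ∀ {u v} → Joins p u v → side u ≢ p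
    off-apex j e = proj₁ (perm3-distinct (joins-sides p j)) (sym e)
    alongEdge : ∀ e u v → T e → Joins (pairOf {X} e) u v → apexLabel p u ≡ apexLabel p v
    alongEdge e u v te j rewrite classP e te with side u ≟P p | side v ≟P p
    ... | yes su | _ = ⊥-elim (off-apex j su)
    ... | no _ | yes sv = ⊥-elim (off-apex (joins-sym p j) sv)
    ... | no _ | no _ = refl
    surj : Surjective _≡_ _≡_ (apexLabel p)
    surj zero = apex (next p) , λ { refl → offLabel }
      where
      offLabel : apexLabel p (apex (next p)) ≡ zero
      offLabel with side (apex (next p)) ≟P p
      ... | yes e = ⊥-elim (proj₁ (perm3-distinct (next-perm p)) (sym (trans (sym (side-apex (next p))) e)))
      ... | no _ = refl
    surj (suc zero) = apex p , λ { refl → apexLab }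
      where
      apexLab : apexLabel p (apex p) ≡ suc zero
      apexLab with side (apex p) ≟P p
      ... | yes _ = refl
      ... | no n = ⊥-elim (n (side-apex p))
    sameLabel : ∀ u v → apexLabel p u ≡ apexLabel p v → Conn {X} T u v
    sameLabel u v e with side u ≟P p | side v ≟P p
    ... | yes su | yes sv = subst (Conn {X} T u) (side-injective (trans su (sym sv))) here
    ... | no su | no sv with u FP.≟ v
    ...   | yes refl = here
    ...   | no uv = subst₂ (Conn {X} T) (apex-side u) (apex-side v)
                      (link-conn tp (perm3 (≢-sym su , (λ e → uv (side-injective e)) , ≢-sym sv)))
    sameLabel u v () | yes _ | no _
    sameLabel u v () | no _ | yes _

module _ {X : Quasigroup} where
  private
    C = Carrier X
    _∙_ = _·_ X

  Tri : C → C → C → Pred (Edge X)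
  Tri g h k = triple⟨ (e12 , g) , (e23 , h) , (e13 , k) ⟩

  label : C → C → C → Pair → C
  label g h k e12 = g
  label g h k e23 = h
  label g h k e13 = k

  tri-label : ∀ {g h k q x} → Tri g h k (q , x) → x ≡ label g h k q
  tri-label (inj₁ refl) = refl
  tri-label (inj₂ (inj₁ refl)) = refl
  tri-label (inj₂ (inj₂ refl)) = refl

  tri-eq : ∀ {g h k g' h' k'} → Tri g h k ⊆ Tri g' h' k' → (g ≡ g') × (h ≡ h') × (k ≡ k')
  tri-eq s = tri-label (s _ (inj₁ refl)) , tri-label (s _ (inj₂ (inj₁ refl))) , tri-label (s _ (inj₂ (inj₂ refl)))

  links-tri : ∀ {a b c x y z} → Perm3 a b c → Σ C λ g → Σ C λ h → Σ C λ k → triple⟨ (a , x) , (b , y) , (c , z) ⟩ ≐ Tri g h k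
  links-tri {x = x} {y} {z} p123 = x , y , z , ≐-refl
  links-tri {x = x} {y} {z} p132 = x , z , y , t132
  links-tri {x = x} {y} {z} p213 = y , x , z , t213
  links-tri {x = x} {y} {z} p231 = z , x , y , t312
  links-tri {x = x} {y} {z} p312 = y , z , x , t231
  links-tri {x = x} {y} {z} p321 = z , y , x , t321

  balancedTri⇒ : ∀ {g h k} → IsBalancedCircle X (Tri g h k) → g ∙ h ≡ k
  balancedTri⇒ (g' , h' , k' , eq , (s , _)) with tri-eq (λ x t → s x t)
  ... | refl , refl , refl = eq

  bc-≐ : ∀ {T T' : Pred (Edge X)} → T ≐ T' → IsBalancedCircle X T → IsBalancedCircle X T'
  bc-≐ e (g , h , k , eq , e') = g , h , k , eq , ≐-trans (≐-sym e) e'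

  circ-≐ : ∀ {T T' : Pred (Edge X)} → T ≐ T' → IsCircle X T → IsCircle X T'
  circ-≐ e (inj₁ (p , g , h , n , e')) = inj₁ (p , g , h , n , ≐-trans (≐-sym e) e')
  circ-≐ e (inj₂ (g , h , k , e')) = inj₂ (g , h , k , ≐-trans (≐-sym e) e')

  tri-circle : ∀ {a b c x y z} → Perm3 a b c → IsCircle X triple⟨ (a , x) , (b , y) , (c , z) ⟩
  tri-circle π with links-tri π
  ... | g , h , k , e = inj₂ (g , h , k , e)

  digon-unbalanced : ∀ {T p x y} → T ≐ pair⟨ (p , x) , (p , y) ⟩ → ¬ IsBalancedCircle X T
  digon-unbalanced {T} {p} (a , b) (g , h , k , _ , (c , d)) = classes (a _ (d _ (inj₁ refl))) (a _ (d _ (inj₂ (inj₁ refl))))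
    where
    classes : pair⟨ (p , _) , (p , _) ⟩ (e12 , g) → pair⟨ (p , _) , (p , _) ⟩ (e23 , h) → ⊥
    classes (inj₁ refl) (inj₁ ())
    classes (inj₁ refl) (inj₂ ())
    classes (inj₂ refl) (inj₁ ())
    classes (inj₂ refl) (inj₂ ())

  digon-unbalancedCircle : ∀ {x y : Edge X} → pairOf {X} x ≡ pairOf {X} y → x ≢ y → IsUnbalancedCircle X pair⟨ x , y ⟩
  digon-unbalancedCircle {q , x'} {.q , y'} refl n = inj₁ (q , x' , y' , (λ e → n (cong (q ,_) e)) , ≐-refl) , digon-unbalanced ≐-refl

  -- a balanced triangle is a balanced edge set: its only circle is itself
  tri-balanced : ∀ {E : Pred (Edge X)} {g h k} → E ≐ Tri g h k → g ∙ h ≡ k → Balanced X E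
  tri-balanced (a , b) eq T sub (inj₁ (p , x , y , ne , (c , d))) =
    ⊥-elim (ne (trans (tri-label (a _ (sub _ (d _ (inj₁ refl))))) (sym (tri-label (a _ (sub _ (d _ (inj₂ refl))))))))
  tri-balanced (a , b) eq T sub (inj₂ (g' , h' , k' , (c , d))) with tri-eq (λ x t → a x (sub x (d x t)))
  ... | refl , refl , refl = g' , h' , k' , eq , (c , d)

  digon-unbalanced-set : ∀ {E : Pred (Edge X)} {p g h} → E (p , g) → E (p , h) → g ≢ h → ¬ Balanced X E
  digon-unbalanced-set {E} {p} {g} {h} eg eh ne bal =
    digon-unbalanced ≐-refl (bal pair⟨ (p , g) , (p , h) ⟩ sub (inj₁ (p , g , h , ne , ≐-refl)))
    where
    sub : pair⟨ (p , g) , (p , h) ⟩ ⊆ E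
    sub _ (inj₁ refl) = eg
    sub _ (inj₂ refl) = eh

Bal3 : (X : Quasigroup) → Edge X → Edge X → Edge X → Set
Bal3 X a b c = IsBalancedCircle X triple⟨ a , b , c ⟩

-- our quasigroups as library quasigroups, for the cancellation laws
asBundle : Quasigroup → Bundles.Quasigroup _ _
asBundle X = record { Carrier = Carrier X ; _≈_ = _≡_ ; _∙_ = _·_ X ; _\\_ = _\\_ X ; _//_ = _//_ X
                    ; isQuasigroup = isQuasigroup X }

module QuasigroupFacts (X : Quasigroup) where
  open AS.IsQuasigroup (isQuasigroup X) using (leftDividesˡ; rightDividesˡ)
  open QuasigroupProperties (asBundle X) using (cancelˡ; cancelʳ; y≈x\\z; x≈z//y) public
  private
    C = Carrier X
    _∙_ = _·_ X
    _\\'_ = _\\_ X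
    _//'_ = _//_ X

  -- the label of the third link of the balanced triangle through x e_a, y e_b
  complete : Pair → C → Pair → C → C
  complete e12 x e23 y = x ∙ y
  complete e23 x e12 y = y ∙ x
  complete e12 x e13 y = x \\' y
  complete e13 x e12 y = y \\' x
  complete e23 x e13 y = y //' x
  complete e13 x e23 y = x //' y
  complete _ x _ _ = x

  complete-balanced : ∀ {a b} x y → a ≢ b → Bal3 X (a , x) (b , y) (third a b , complete a x b y)
  complete-balanced x y ab with third-perm ab
  ... | p123 = x , y , x ∙ y , refl , ≐-refl
  ... | p132 = x , x \\' y , y , leftDividesˡ x y , t132
  ... | p213 = y , x , y ∙ x , refl , t213
  ... | p231 = y //' x , x , y , rightDividesˡ x y , t312
  ... | p312 = y , y \\' x , x , leftDividesˡ y x , t231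
  ... | p321 = x //' y , y , x , rightDividesˡ y x , t321

  complete-unique : ∀ {a b c x y z} → Perm3 a b c → Bal3 X (a , x) (b , y) (c , z) → z ≡ complete a x b y
  complete-unique p123 B = sym (balancedTri⇒ {X} B)
  complete-unique p132 B = y≈x\\z _ _ _ (balancedTri⇒ {X} (bc-≐ {X} t132 B))
  complete-unique p213 B = sym (balancedTri⇒ {X} (bc-≐ {X} t213 B))
  complete-unique p231 B = x≈z//y _ _ _ (balancedTri⇒ {X} (bc-≐ {X} t312 B))
  complete-unique p312 B = y≈x\\z _ _ _ (balancedTri⇒ {X} (bc-≐ {X} t231 B))
  complete-unique p321 B = x≈z//y _ _ _ (balancedTri⇒ {X} (bc-≐ {X} t321 B))

-- Among any three elements two
-- coincide, which with cancellation makes x·y = z invariant under all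
-- permutations of x, y, z (total symmetry); moreover all squares are equal
-- and idempotent, and a second element is never idempotent.

module SmallQuasigroup (X : Quasigroup) (le2 : CardLe2 X) where
  open QuasigroupFacts X using (cancelˡ; cancelʳ)
  private
    _∙_ = _·_ X

  swap₁₃ : ∀ {x y z} → x ∙ y ≡ z → z ∙ y ≡ x
  swap₁₃ {x} {y} {z} eq with le2 x (z ∙ y) z
  ... | inj₁ e = sym e
  ... | inj₂ (inj₁ e) = trans e (cancelʳ y z x (trans e (sym eq)))
  ... | inj₂ (inj₂ e) = trans (cong (_∙ y) (sym e)) (trans eq (sym e))

  swap₂₃ : ∀ {x y z} → x ∙ y ≡ z → x ∙ z ≡ y
  swap₂₃ {x} {y} {z} eq with le2 y (x ∙ z) z
  ... | inj₁ e = sym e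
  ... | inj₂ (inj₁ e) = trans e (cancelˡ x z y (trans e (sym eq)))
  ... | inj₂ (inj₂ e) = trans (cong (x ∙_) (sym e)) (trans eq (sym e))

  swap₁₂ : ∀ {x y z} → x ∙ y ≡ z → y ∙ x ≡ z
  swap₁₂ e = swap₁₃ (swap₂₃ (swap₁₃ e))

  balanced-any-order : ∀ {a b c g h k} → Perm3 a b c → (Bal3 X (a , g) (b , h) (c , k) → g ∙ h ≡ k) × (g ∙ h ≡ k → Bal3 X (a , g) (b , h) (c , k))
  balanced-any-order p123 = (λ B → balancedTri⇒ {X} B) , λ e → _ , _ , _ , e , ≐-refl
  balanced-any-order p132 = (λ B → swap₂₃ (balancedTri⇒ {X} (bc-≐ {X} t132 B))) , λ e → _ , _ , _ , swap₂₃ e , t132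
  balanced-any-order p213 = (λ B → swap₁₂ (balancedTri⇒ {X} (bc-≐ {X} t213 B))) , λ e → _ , _ , _ , swap₁₂ e , t213
  balanced-any-order p231 = (λ B → swap₁₂ (swap₁₃ (balancedTri⇒ {X} (bc-≐ {X} t312 B)))) , λ e → _ , _ , _ , swap₂₃ (swap₁₃ e) , t312
  balanced-any-order p312 = (λ B → swap₂₃ (swap₁₃ (balancedTri⇒ {X} (bc-≐ {X} t231 B)))) , λ e → _ , _ , _ , swap₂₃ (swap₁₂ e) , t231
  balanced-any-order p321 = (λ B → swap₁₃ (balancedTri⇒ {X} (bc-≐ {X} t321 B))) , λ e → _ , _ , _ , swap₁₃ e , t321

  idempotent-unique : ∀ {g h} → g ∙ g ≡ g → h ∙ h ≡ h → g ≡ h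
  idempotent-unique {g} {h} eg eh with le2 g h (g ∙ h)
  ... | inj₁ e = e
  ... | inj₂ (inj₁ e) = sym (cancelʳ h h g (trans eh e))
  ... | inj₂ (inj₂ e) = cancelˡ g g h (trans eg e)

  square-constant : ∀ g h → g ∙ g ≡ h ∙ h
  square-constant g h with le2 g h (g ∙ g)
  ... | inj₁ refl = refl
  ... | inj₂ (inj₁ e) = trans (sym e) (sym h-idempotent)
    where
    h-idempotent : h ∙ h ≡ h
    h-idempotent with le2 h (h ∙ h) g
    ... | inj₁ e' = sym e'
    ... | inj₂ (inj₁ e') with cancelˡ h h g (trans e' (sym (swap₁₃ (sym e))))
    ...   | refl = e'
    h-idempotent | inj₂ (inj₂ refl) = sym e
  ... | inj₂ (inj₂ e) = trans (sym e) (sym h²≡g)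
    where
    h²≡g : h ∙ h ≡ g
    h²≡g with le2 h (h ∙ h) g
    ... | inj₁ e' = trans (sym e') (idempotent-unique (sym e') (sym e))
    ... | inj₂ (inj₁ e') = e'
    ... | inj₂ (inj₂ refl) = sym e

  square-idempotent : ∀ g → (g ∙ g) ∙ (g ∙ g) ≡ g ∙ g
  square-idempotent g = square-constant (g ∙ g) g

  idempotent-split : ∀ {g h} → g ≢ h → (g ∙ g ≡ g × h ∙ h ≡ g) ⊎ (h ∙ h ≡ h × g ∙ g ≡ h)
  idempotent-split {g} {h} n with le2 g h (g ∙ g)
  ... | inj₁ e = ⊥-elim (n e)
  ... | inj₂ (inj₁ e) = inj₂ (trans (square-constant h g) (sym e) , sym e)
  ... | inj₂ (inj₂ e) = inj₁ (sym e , trans (square-constant h g) (sym e))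

-- Rank3 X a b c r says that
-- {a, b, c} has rank r; as a record it lets Agda infer the three points.

record Rank3 (X : Quasigroup) (a b c : L0Elem X) (r : ℕ) : Set₁ where
  constructor rank3
  field rankIs : RankIs X triple⟨ a , b , c ⟩ r

module _ {X : Quasigroup} where
  private
    C = Carrier X
    _∙_ = _·_ X
    L = L0Elem X

  edges-≐ : {S S' : Pred L} → S ≐ S' → edgesOf {X} S ≐ edgesOf {X} S'
  edges-≐ (a , b) = (λ e s → a (just e) s) , (λ e s → b (just e) s)

  balanced-⊆ : {E E' : Pred (Edge X)} → E' ⊆ E → Balanced X E → Balanced X E'
  balanced-⊆ s bal T sub c = bal T (λ x t → s x (sub x t)) c

  rank-≐ : {S S' : Pred L} {r : ℕ} → S ≐ S' → RankIs X S r → RankIs X S' r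
  rank-≐ eq@(a , b) (inj₁ (nS , bal , k , nc , e)) =
    inj₁ ((λ s → nS (b _ s)) , balanced-⊆ (proj₂ (edges-≐ eq)) bal , k , nc-≐ (edges-≐ eq) nc , e)
  rank-≐ eq@(a , b) (inj₂ (inj₁ s , k , nc , e)) = inj₂ (inj₁ (a _ s) , k , nc-≐ (edges-≐ eq) nc , e)
  rank-≐ eq@(a , b) (inj₂ (inj₂ nb , k , nc , e)) =
    inj₂ (inj₂ (λ bal → nb (balanced-⊆ (proj₁ (edges-≐ eq)) bal)) , k , nc-≐ (edges-≐ eq) nc , e)

  -- RankIs is functional: c(S ∖ {e₀}) is unique and balance is decided
  rank-unique : {S : Pred L} {r r' : ℕ} → RankIs X S r → RankIs X S r' → r ≡ r'
  rank-unique {r = r} {r'} (inj₁ (_ , _ , k , nc , e)) (inj₁ (_ , _ , k' , nc' , e'))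
    rewrite nc-unique nc nc' = NP.+-cancelʳ-≡ k' r r' (trans e (sym e'))
  rank-unique {r = r} {r'} (inj₂ (_ , k , nc , e)) (inj₂ (_ , k' , nc' , e'))
    rewrite nc-unique nc nc' = NP.+-cancelʳ-≡ k' r r' (trans e (sym e'))
  rank-unique (inj₁ (nS , _)) (inj₂ (inj₁ s , _)) = ⊥-elim (nS s)
  rank-unique (inj₁ (_ , bal , _)) (inj₂ (inj₂ nb , _)) = ⊥-elim (nb bal)
  rank-unique (inj₂ (inj₁ s , _)) (inj₁ (nS , _)) = ⊥-elim (nS s)
  rank-unique (inj₂ (inj₂ nb , _)) (inj₁ (_ , bal , _)) = ⊥-elim (nb bal)

  rank2≢3 : {a b c : L} → Rank3 X a b c 2 → Rank3 X a b c 3 → ⊥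
  rank2≢3 {a} {b} {c} (rank3 R) (rank3 R') with rank-unique {triple⟨ a , b , c ⟩} R R'
  ... | ()

  reorder : ∀ {a b c a' b' c' : L} {r} → triple⟨ a , b , c ⟩ ≐ triple⟨ a' , b' , c' ⟩ → Rank3 X a b c r → Rank3 X a' b' c' r
  reorder e (rank3 R) = rank3 (rank-≐ e R)

  rank-cong : ∀ {x y z x' y' z' : L} {r} → x ≡ x' → y ≡ y' → z ≡ z' → Rank3 X x y z r → Rank3 X x' y' z' r
  rank-cong refl refl refl R = R

  values : ∀ {q} {u v : C} → _≢_ {A = L} (just (q , u)) (just (q , v)) → u ≢ v
  values n e = n (cong (λ w → just (_ , w)) e)

  private
    edges-of-links : ∀ {a b c : Edge X} → edgesOf {X} triple⟨ just a , just b , just c ⟩ ≐ triple⟨ a , b , c ⟩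
    edges-of-links = to , from
      where
      to : ∀ {a b c : Edge X} → edgesOf {X} triple⟨ just a , just b , just c ⟩ ⊆ triple⟨ a , b , c ⟩
      to _ (inj₁ refl) = inj₁ refl
      to _ (inj₂ (inj₁ refl)) = inj₂ (inj₁ refl)
      to _ (inj₂ (inj₂ refl)) = inj₂ (inj₂ refl)
      from : ∀ {a b c : Edge X} → triple⟨ a , b , c ⟩ ⊆ edgesOf {X} triple⟨ just a , just b , just c ⟩
      from _ (inj₁ refl) = inj₁ refl
      from _ (inj₂ (inj₁ refl)) = inj₂ (inj₁ refl)
      from _ (inj₂ (inj₂ refl)) = inj₂ (inj₂ refl)

    no-e₀ : ∀ {a b c : Edge X} → ¬ triple⟨ just a , just b , just c ⟩ (e₀ {X})
    no-e₀ (inj₁ ())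
    no-e₀ (inj₂ (inj₁ ()))
    no-e₀ (inj₂ (inj₂ ()))

  rank2-e₀ : ∀ {p g h} → Rank3 X nothing (just (p , g)) (just (p , h)) 2
  rank2-e₀ {p} = rank3 (inj₂ (inj₁ (inj₁ refl) , 2 , nc-two (inj₂ (inj₁ refl)) classP , refl))
    where
    classP : ∀ e → edgesOf {X} triple⟨ nothing , just (p , _) , just (p , _) ⟩ e → pairOf {X} e ≡ p
    classP _ (inj₂ (inj₁ refl)) = refl
    classP _ (inj₂ (inj₂ refl)) = refl

  rank3-e₀ : ∀ {p q g h} → p ≢ q → Rank3 X nothing (just (p , g)) (just (q , h)) 3
  rank3-e₀ pq = rank3 (inj₂ (inj₁ (inj₁ refl) , 1 , nc-one (connected (inj₂ (inj₁ refl)) (inj₂ (inj₂ refl)) pq) , refl))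

  rank2-parallel : ∀ {p g h k} → g ≢ h → Rank3 X (just (p , g)) (just (p , h)) (just (p , k)) 2
  rank2-parallel {p} {g} {h} {k} gh = rank3 (inj₂ (inj₂ unbalanced , 2 , nc-two (inj₁ refl) classP , refl))
    where
    unbalanced = digon-unbalanced-set {X} {E = edgesOf {X} triple⟨ just (p , g) , just (p , h) , just (p , k) ⟩}
                   (inj₁ refl) (inj₂ (inj₁ refl)) gh
    classP : ∀ e → edgesOf {X} triple⟨ just (p , _) , just (p , _) , just (p , _) ⟩ e → pairOf {X} e ≡ p
    classP _ (inj₁ refl) = refl
    classP _ (inj₂ (inj₁ refl)) = refl
    classP _ (inj₂ (inj₂ refl)) = refl

  rank3-digon : ∀ {p q g h k} → g ≢ h → p ≢ q → Rank3 X (just (p , g)) (just (p , h)) (just (q , k)) 3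
  rank3-digon {p} {q} {g} {h} {k} gh pq =
    rank3 (inj₂ (inj₂ unbalanced , 1 , nc-one (connected (inj₁ refl) (inj₂ (inj₂ refl)) pq) , refl))
    where
    unbalanced = digon-unbalanced-set {X} {E = edgesOf {X} triple⟨ just (p , g) , just (p , h) , just (q , k) ⟩}
                   (inj₁ refl) (inj₂ (inj₁ refl)) gh

  private
    triangle-connected : ∀ {g h k} → NumComponents {X} (edgesOf {X} triple⟨ just (e12 , g) , just (e23 , h) , just (e13 , k) ⟩) 1
    triangle-connected = nc-one (connected (inj₁ refl) (inj₂ (inj₁ refl)) (λ ()))

  rank2-tri : ∀ {g h k} → g ∙ h ≡ k → Rank3 X (just (e12 , g)) (just (e23 , h)) (just (e13 , k)) 2
  rank2-tri {g} {h} {k} e =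
    rank3 (inj₁ (no-e₀ , tri-balanced {X} {E = edgesOf {X} triple⟨ just (e12 , g) , just (e23 , h) , just (e13 , k) ⟩} edges-of-links e ,
                 1 , triangle-connected , refl))

  rank2-tri⇒ : ∀ {g h k} → Rank3 X (just (e12 , g)) (just (e23 , h)) (just (e13 , k)) 2 → g ∙ h ≡ k
  rank2-tri⇒ {g} {h} {k} (rank3 (inj₁ (_ , bal , _))) = balancedTri⇒ {X} (bal _ (proj₂ edges-of-links) (inj₂ (g , h , k , ≐-refl)))
  rank2-tri⇒ (rank3 (inj₂ (_ , _ , nc , e))) with nc-unique nc triangle-connected
  rank2-tri⇒ (rank3 (inj₂ (_ , _ , nc , ()))) | refl

  private
    lift≐ : ∀ {x y z a b c : Edge X} → triple⟨ x , y , z ⟩ ≐ triple⟨ a , b , c ⟩ →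
      triple⟨ just x , just y , just z ⟩ ≐ triple⟨ just a , just b , just c ⟩
    lift≐ e = ≐-trans (≐-sym (img-triple just)) (≐-trans (img-≐ just e) (img-triple just))

  balanced⇒rank2 : ∀ {a b c x y z} → Perm3 a b c →
    IsBalancedCircle X triple⟨ (a , x) , (b , y) , (c , z) ⟩ → Rank3 X (just (a , x)) (just (b , y)) (just (c , z)) 2
  balanced⇒rank2 π B with links-tri {X} π
  ... | _ , _ , _ , e = reorder (≐-sym (lift≐ e)) (rank2-tri (balancedTri⇒ {X} (bc-≐ {X} e B)))

  rank2⇒balanced : ∀ {a b c x y z} → Perm3 a b c →
    Rank3 X (just (a , x)) (just (b , y)) (just (c , z)) 2 → IsBalancedCircle X triple⟨ (a , x) , (b , y) , (c , z) ⟩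
  rank2⇒balanced π R with links-tri {X} π
  ... | _ , _ , _ , e = _ , _ , _ , rank2-tri⇒ (reorder (lift≐ e) R) , e

  e₀-line⇒class : ∀ {p q g h} → Rank3 X nothing (just (p , g)) (just (q , h)) 2 → p ≡ q
  e₀-line⇒class {p} {q} R with p ≟P q
  ... | yes pq = pq
  ... | no pq = ⊥-elim (rank2≢3 R (rank3-e₀ pq))

  e₀-nonline⇒class : ∀ {p q g h} → Rank3 X nothing (just (p , g)) (just (q , h)) 3 → p ≢ q
  e₀-nonline⇒class R refl = rank2≢3 rank2-e₀ R

  -- the class line L_p = {e₀} ∪ {x e_p}: any three of its points form a line
  OnClassLine : Pair → L → Set
  OnClassLine p t = t ≡ nothing ⊎ Σ C (λ x → t ≡ just (p , x))

  classLine-rank2 : ∀ {p} {t₁ t₂ t₃ : L} → OnClassLine p t₁ → OnClassLine p t₂ → OnClassLine p t₃ →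
    t₁ ≢ t₂ → t₂ ≢ t₃ → t₁ ≢ t₃ → Rank3 X t₁ t₂ t₃ 2
  classLine-rank2 (inj₁ refl) (inj₁ refl) _ n₁₂ _ _ = ⊥-elim (n₁₂ refl)
  classLine-rank2 _ (inj₁ refl) (inj₁ refl) _ n₂₃ _ = ⊥-elim (n₂₃ refl)
  classLine-rank2 (inj₁ refl) _ (inj₁ refl) _ _ n₁₃ = ⊥-elim (n₁₃ refl)
  classLine-rank2 (inj₁ refl) (inj₂ (_ , refl)) (inj₂ (_ , refl)) _ _ _ = rank2-e₀
  classLine-rank2 (inj₂ (_ , refl)) (inj₁ refl) (inj₂ (_ , refl)) _ _ _ = reorder t213 rank2-e₀
  classLine-rank2 (inj₂ (_ , refl)) (inj₂ (_ , refl)) (inj₁ refl) _ _ _ = reorder t231 rank2-e₀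
  classLine-rank2 (inj₂ (_ , refl)) (inj₂ (_ , refl)) (inj₂ (_ , refl)) n₁₂ _ _ = rank2-parallel (values n₁₂)

  line-third : ∀ {p q x y} {t : L} → p ≢ q → just (p , x) ≢ t → just (q , y) ≢ t →
    Rank3 X (just (p , x)) (just (q , y)) t 2 → Σ C λ z → t ≡ just (third p q , z)
  line-third {t = nothing} pq _ _ R = ⊥-elim (rank2≢3 (reorder t312 R) (rank3-e₀ pq))
  line-third {p} {q} {t = just (s , z)} pq px qy R with s ≟P p | s ≟P q
  ... | yes refl | _ = ⊥-elim (rank2≢3 (reorder t132 R) (rank3-digon (values px) pq))
  ... | no _ | yes refl = ⊥-elim (rank2≢3 (reorder t231 R) (rank3-digon (values qy) (≢-sym pq)))
  ... | no sp | no sq = z , cong (λ c → just (c , z)) (third-unique (pq , ≢-sym sq , ≢-sym sp))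

module _ {X : Quasigroup} where
  line-classes : ∀ {a b c x y z} → just (a , x) ≢ just (b , y) → just (b , y) ≢ just (c , z) → just (a , x) ≢ just (c , z) →
    Rank3 X (just (a , x)) (just (b , y)) (just (c , z)) 2 → (a ≡ b × b ≡ c) ⊎ Distinct3 a b c
  line-classes {a} {b} {c} n₁ n₂ n₃ R with a ≟P b | b ≟P c | a ≟P c
  ... | yes e₁ | yes e₂ | _ = inj₁ (e₁ , e₂)
  ... | yes refl | no m₂ | _ = ⊥-elim (rank2≢3 R (rank3-digon (values {X} n₁) m₂))
  ... | no m₁ | yes refl | _ = ⊥-elim (rank2≢3 (reorder t231 R) (rank3-digon (values {X} n₂) (≢-sym m₁)))
  ... | no m₁ | no m₂ | yes refl = ⊥-elim (rank2≢3 (reorder t132 R) (rank3-digon (values {X} n₃) m₁))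
  ... | no m₁ | no m₂ | no m₃ = inj₂ (m₁ , m₂ , m₃)

  line-through-link : ∀ {p g' a b x w} → a ≢ p → b ≢ p → just (a , x) ≢ just (b , w) →
    Rank3 X (just (p , g')) (just (a , x)) (just (b , w)) 2 → a ≢ b × Bal3 X (p , g') (a , x) (b , w)
  line-through-link {a = a} {b} ap bp n R with a ≟P b
  ... | yes refl = ⊥-elim (rank2≢3 (reorder t231 R) (rank3-digon (values {X} n) ap))
  ... | no ab = ab , rank2⇒balanced (perm3 (≢-sym ap , ab , ≢-sym bp)) R

module EdgeMapMono (Q Q' : Quasigroup) (ψ : Edge Q → Edge Q') (ψ-inj : Injective _≡_ _≡_ ψ)
  (s : Pair → Pair) (s-inj : Injective _≡_ _≡_ s)
  (ψ-class : ∀ p g → pairOf {Q'} (ψ (p , g)) ≡ s p)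
  (balanced⇔ : ∀ g h k → (_·_ Q g h ≡ k → IsBalancedCircle Q' triple⟨ ψ (e12 , g) , ψ (e23 , h) , ψ (e13 , k) ⟩)
                        × (IsBalancedCircle Q' triple⟨ ψ (e12 , g) , ψ (e23 , h) , ψ (e13 , k) ⟩ → _·_ Q g h ≡ k))
  where

  φ : Node → Node
  φ u = apex (s (side u))

  φ-inj : Injective _≡_ _≡_ φ
  φ-inj e = side-injective (s-inj (apex-injective e))

  s-perm : ∀ {a b c} → Perm3 a b c → Perm3 (s a) (s b) (s c)
  s-perm π with perm3-distinct π
  ... | ab , bc , ac = perm3 ((λ e → ab (s-inj e)) , (λ e → bc (s-inj e)) , (λ e → ac (s-inj e)))

  -- incidence is preserved since a link of class p joins the apexes of the other two
  joins : ∀ e u v → Joins (pairOf {Q} e) u v → Joins (pairOf {Q'} (ψ e)) (φ u) (φ v)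
  joins (p , g) u v j rewrite ψ-class p g = joins-apex (s-perm (joins-sides p j))

  imageTri : ∀ {T g h k} → T ≐ Tri {Q} g h k → img ψ T ≐ triple⟨ ψ (e12 , g) , ψ (e23 , h) , ψ (e13 , k) ⟩
  imageTri e = ≐-trans (img-≐ ψ e) (img-triple ψ)

  imageTri-perm : ∀ g h k → Perm3 (pairOf {Q'} (ψ (e12 , g))) (pairOf {Q'} (ψ (e23 , h))) (pairOf {Q'} (ψ (e13 , k)))
  imageTri-perm g h k rewrite ψ-class e12 g | ψ-class e23 h | ψ-class e13 k = s-perm p123

  balanced : ∀ T → IsBalancedCircle Q T → IsBalancedCircle Q' (img ψ T)
  balanced T (g , h , k , eq , e) = bc-≐ {Q'} (≐-sym (imageTri e)) (proj₁ (balanced⇔ g h k) eq)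

  unbalanced : ∀ T → IsUnbalancedCircle Q T → IsUnbalancedCircle Q' (img ψ T)
  unbalanced T (inj₁ (p , g , h , gh , e) , _) with digon-unbalancedCircle {Q'} {ψ (p , g)} {ψ (p , h)}
                                                     (trans (ψ-class p g) (sym (ψ-class p h))) (λ eq → gh (cong proj₂ (ψ-inj eq)))
  ... | circle , notBalanced = circ-≐ {Q'} (≐-sym image) circle , λ B → notBalanced (bc-≐ {Q'} image B)
    where
    image : img ψ T ≐ pair⟨ ψ (p , g) , ψ (p , h) ⟩
    image = ≐-trans (img-≐ ψ e) (img-pair ψ)
  unbalanced T (inj₂ (g , h , k , e) , nb) =
    circ-≐ {Q'} (≐-sym (imageTri e)) (tri-circle {Q'} (imageTri-perm g h k)) ,
    λ B → nb (g , h , k , proj₂ (balanced⇔ g h k) (bc-≐ {Q'} (imageTri e) B) , e)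

  isMono : IsBiasedGraphMono Q Q' φ ψ
  isMono = φ-inj , ψ-inj , joins , balanced , unbalanced

module MatroidMono (Q Q' : Quasigroup) (θ : L0Elem Q → L0Elem Q') (mono : IsMatroidMono Q Q' θ) where
  private
    _∙_ = _·_ Q

  θ-inj : Injective _≡_ _≡_ θ
  θ-inj = proj₁ mono

  θ-distinct : ∀ {x y} → x ≢ y → θ x ≢ θ y
  θ-distinct n e = n (θ-inj e)

  link-distinct : ∀ {p q u v} → _≢_ {A = Edge Q} (p , u) (q , v) → θ (just (p , u)) ≢ θ (just (q , v))
  link-distinct n = θ-distinct (λ e → n (just-injective e))

  preserve : ∀ {x y z r} → Rank3 Q x y z r → Rank3 Q' (θ x) (θ y) (θ z) r
  preserve {x} {y} {z} {r} (rank3 R) = rank3 (rank-≐ (img-triple θ) (proj₁ (proj₂ mono triple⟨ x , y , z ⟩ r) R))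

  reflect : ∀ {x y z r} → Rank3 Q' (θ x) (θ y) (θ z) r → Rank3 Q x y z r
  reflect {x} {y} {z} {r} (rank3 R) = rank3 (proj₂ (proj₂ mono triple⟨ x , y , z ⟩ r) (rank-≐ (≐-sym (img-triple θ)) R))

  -- If θ e₀ is a link of class p, then every link g e_q lying on a line
  -- {e₀, g e_q, h e_q} whose class q has at least three links is sent into
  -- the class line L_p.  (Four points of L₀(Q' K₃), three lines among them.)
  classLine-image : ∀ {p g' q u v w} → θ nothing ≡ just (p , g') → u ≢ v → v ≢ w → u ≢ w →
    OnClassLine {Q'} p (θ (just (q , u)))
  classLine-image {p} {g'} {q} {u} {v} {w} eP uv vw uw = onLine _ refl
    where
    P≢ : ∀ v' → just (p , g') ≢ θ (just (q , v'))
    P≢ v' e = θ-distinct (λ ()) (trans eP e)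
    line : ∀ v' → Rank3 Q' (just (p , g')) (θ (just (q , u))) (θ (just (q , v'))) 2
    line v' = rank-cong eP refl refl (preserve (rank2-e₀ {Q}))
    onLine : ∀ t → θ (just (q , u)) ≡ t → OnClassLine {Q'} p t
    onLine nothing _ = inj₁ refl
    onLine (just (q' , x)) eu with q' ≟P p
    ... | yes refl = inj₂ (x , refl)
    ... | no q'p with line-third {Q'} pq' (P≢ v) (u≢ v uv) (third-point v) | line-third {Q'} pq' (P≢ w) (u≢ w uw) (third-point w)
      where
      pq' : p ≢ q'
      pq' e = q'p (sym e)
      u≢ : ∀ v' → u ≢ v' → just (q' , x) ≢ θ (just (q , v'))
      u≢ v' n e = link-distinct (λ e' → n (cong proj₂ e')) (trans eu e)
      third-point : ∀ v' → Rank3 Q' (just (p , g')) (just (q' , x)) (θ (just (q , v'))) 2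
      third-point v' = rank-cong refl eu refl (line v')
    ... | y , ev | z , ew =
      ⊥-elim (rank2≢3 (reorder t231 (rank-cong eu ev ew (preserve (rank2-parallel {Q} {q} {k = w} uv))))
                      (rank3-digon (λ e → link-distinct (λ e' → vw (cong proj₂ e')) (trans ev (trans (cong (λ c → just (_ , c)) e) (sym ew))))
                                   (λ e → proj₁ (proj₂ (third-distinct (λ e' → q'p (sym e')))) (sym e))))

  -- When #Q > 2, θ fixes e₀: otherwise the images of a e12, b e23 and of
  -- both a e13 and b e13 would lie on one class line, forcing a·b = a = b.
  e₀-fixed : CardGt2 Q → θ nothing ≡ nothing
  e₀-fixed (a , b , c , ab , bc , ac) with θ nothing in eP
  ... | nothing = refl
  ... | just (p , g') = ⊥-elim (ab (trans (sym (product a (onLine e13 ab bc ac))) (product b (onLine e13 ba ac bc))))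
    where
    ba : b ≢ a
    ba e = ab (sym e)
    onLine : ∀ q {u v w} → u ≢ v → v ≢ w → u ≢ w → OnClassLine {Q'} p (θ (just (q , u)))
    onLine q = classLine-image eP
    product : ∀ k → OnClassLine {Q'} p (θ (just (e13 , k))) → a ∙ b ≡ k
    product k onk = rank2-tri⇒ (reflect (classLine-rank2 (onLine e12 ab bc ac) (onLine e23 ba ac bc) onk
                                         (link-distinct λ ()) (link-distinct λ ()) (link-distinct λ ())))

  module FixingE₀ (θe₀ : θ nothing ≡ nothing) where

    linkImage : ∀ e → Σ (Edge Q') λ e' → θ (just e) ≡ just e'
    linkImage e with θ (just e) in eq
    ... | just e' = e' , refl
    ... | nothing with θ-inj (trans eq (sym θe₀))
    ...   | ()

    ψ : Edge Q → Edge Q'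
    ψ e = proj₁ (linkImage e)

    θ-link : ∀ e → θ (just e) ≡ just (ψ e)
    θ-link e = proj₂ (linkImage e)

    ψ-inj : Injective _≡_ _≡_ ψ
    ψ-inj {e} {e'} eq = just-injective (θ-inj (trans (θ-link e) (trans (cong just eq) (sym (θ-link e')))))

    θ̂ : L0Elem Q → L0Elem Q'
    θ̂ nothing = nothing
    θ̂ (just e) = just (ψ e)

    θ≗θ̂ : ∀ x → θ x ≡ θ̂ x
    θ≗θ̂ nothing = θe₀
    θ≗θ̂ (just e) = θ-link e

    preservê : ∀ {x y z r} → Rank3 Q x y z r → Rank3 Q' (θ̂ x) (θ̂ y) (θ̂ z) r
    preservê R = rank-cong (θ≗θ̂ _) (θ≗θ̂ _) (θ≗θ̂ _) (preserve R)

    reflect̂ : ∀ {x y z r} → Rank3 Q' (θ̂ x) (θ̂ y) (θ̂ z) r → Rank3 Q x y z r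
    reflect̂ R = reflect (rank-cong (sym (θ≗θ̂ _)) (sym (θ≗θ̂ _)) (sym (θ≗θ̂ _)) R)

    classOf : Edge Q → Pair
    classOf e = pairOf {Q'} (ψ e)

    same-class : ∀ p g h → classOf (p , g) ≡ classOf (p , h)
    same-class p g h = e₀-line⇒class (preservê (rank2-e₀ {Q} {p} {g} {h}))

    distinct-class : ∀ {p q} g h → p ≢ q → classOf (p , g) ≢ classOf (q , h)
    distinct-class g h pq = e₀-nonline⇒class (preservê (rank3-e₀ {Q} {g = g} {h} pq))

    class-perm : ∀ {a b c} g h k → Perm3 a b c → Perm3 (classOf (a , g)) (classOf (b , h)) (classOf (c , k))
    class-perm g h k π with perm3-distinct π
    ... | ab , bc , ac = perm3 (distinct-class g h ab , distinct-class h k bc , distinct-class g k ac)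

    balanced-links⇔ : ∀ {a b c g h k} → Perm3 a b c →
      (Bal3 Q (a , g) (b , h) (c , k) → Bal3 Q' (ψ (a , g)) (ψ (b , h)) (ψ (c , k)))
      × (Bal3 Q' (ψ (a , g)) (ψ (b , h)) (ψ (c , k)) → Bal3 Q (a , g) (b , h) (c , k))
    balanced-links⇔ {g = g} {h} {k} π =
      (λ B → rank2⇒balanced (class-perm g h k π) (preservê (balanced⇒rank2 π B))) ,
      (λ B → rank2⇒balanced π (reflect̂ (balanced⇒rank2 (class-perm g h k π) B)))

    balanced⇔ : ∀ g h k → (_∙_ g h ≡ k → IsBalancedCircle Q' triple⟨ ψ (e12 , g) , ψ (e23 , h) , ψ (e13 , k) ⟩)
                        × (IsBalancedCircle Q' triple⟨ ψ (e12 , g) , ψ (e23 , h) , ψ (e13 , k) ⟩ → _∙_ g h ≡ k)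
    balanced⇔ g h k = (λ e → proj₁ (balanced-links⇔ p123) (g , h , k , e , ≐-refl)) ,
                      (λ B → balancedTri⇒ {Q} (proj₂ (balanced-links⇔ p123) B))

    -- with an element a at hand, the class permutation is p ↦ classOf (p , a)
    -- and ψ itself is the required monomorphism, induced by θ
    induced : Carrier Q → Σ (BiasedGraphMono Q Q') (λ θ'' → Induces Q Q' θ θ'')
    induced a = (M.φ , ψ , M.isMono) , θ-link
      where
      s : Pair → Pair
      s p = classOf (p , a)
      s-inj : Injective _≡_ _≡_ s
      s-inj {p} {q} e with p ≟P q
      ... | yes pq = pq
      ... | no pq = ⊥-elim (distinct-class a a pq e)
      module M = EdgeMapMono Q Q' ψ ψ-inj s s-inj (λ p g → same-class p g a) balanced⇔

    -- Without an element of Q at hand the class permutation p ↦ classOf (p , g)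
    -- cannot be fixed once and for all; instead precompose ψ with its inverse,
    -- computed separately at every g.  The resulting map preserves classes, and
    -- it still preserves balance because for #Q ≤ 2 the relation g·h = k is
    -- totally symmetric.
    normalised : CardLe2 Q → BiasedGraphMono Q Q'
    normalised le2 = M.φ , ψ' , M.isMono
      where
      open SmallQuasigroup Q le2 using (balanced-any-order)
      σ : Carrier Q → Pair → Pair
      σ g p = classOf (p , g)
      σ-distinct : ∀ g → Distinct3 (σ g e12) (σ g e23) (σ g e13)
      σ-distinct g = perm3-distinct (class-perm g g g p123)
      σ-select : ∀ g p → σ g p ≡ select (σ g e12) (σ g e23) (σ g e13) p
      σ-select g e12 = refl
      σ-select g e23 = refl
      σ-select g e13 = refl
      σ⁻¹ : Carrier Q → Pair → Pair
      σ⁻¹ g = position (σ g e12) (σ g e23) (σ g e13)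
      σσ⁻¹ : ∀ g p → σ g (σ⁻¹ g p) ≡ p
      σσ⁻¹ g p = trans (σ-select g (σ⁻¹ g p)) (select-position (σ-distinct g) p)
      σ⁻¹-const : ∀ g h p → σ⁻¹ h p ≡ σ⁻¹ g p
      σ⁻¹-const g h p rewrite same-class e12 h g | same-class e23 h g | same-class e13 h g = refl

      ψ' : Edge Q → Edge Q'
      ψ' (p , g) = ψ (σ⁻¹ g p , g)

      ψ'-class : ∀ p g → pairOf {Q'} (ψ' (p , g)) ≡ p
      ψ'-class p g = σσ⁻¹ g p

      ψ'-inj : Injective _≡_ _≡_ ψ'
      ψ'-inj {p , g} {q , h} e with trans (sym (ψ'-class p g)) (trans (cong (pairOf {Q'}) e) (ψ'-class q h))
      ... | refl with cong proj₂ (ψ-inj e)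
      ...   | refl = refl

      balanced⇔' : ∀ g h k → (_∙_ g h ≡ k → IsBalancedCircle Q' triple⟨ ψ' (e12 , g) , ψ' (e23 , h) , ψ' (e13 , k) ⟩)
                           × (IsBalancedCircle Q' triple⟨ ψ' (e12 , g) , ψ' (e23 , h) , ψ' (e13 , k) ⟩ → _∙_ g h ≡ k)
      balanced⇔' g h k rewrite σ⁻¹-const g h e23 | σ⁻¹-const g k e13 =
        (λ e → proj₁ (balanced-links⇔ π) (proj₂ (balanced-any-order π) e)) ,
        (λ B → proj₁ (balanced-any-order π) (proj₂ (balanced-links⇔ π) B))
        where
        π : Perm3 (σ⁻¹ g e12) (σ⁻¹ g e23) (σ⁻¹ g e13)
        π = position-perm (σ-distinct g)

      module M = EdgeMapMono Q Q' ψ' ψ'-inj (λ p → p) (λ e → e) ψ'-class balanced⇔'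

-- Sections of X, assigning a label to each class.  MixedBalanced F G says
-- that the label of F at any class together with the labels of G at the two
-- other classes form a balanced triangle; for F = G this says that the links
-- q ↦ F q themselves form one.

module Mixed (X : Quasigroup) where
  private
    C = Carrier X

  Bal3-cong : ∀ {a b c x y z x' y' z'} → x ≡ x' → y ≡ y' → z ≡ z' → Bal3 X (a , x) (b , y) (c , z) → Bal3 X (a , x') (b , y') (c , z')
  Bal3-cong refl refl refl B = B

  MixedBalanced : (Pair → C) → (Pair → C) → Set
  MixedBalanced F G = ∀ {z w₁ w₂} → Perm3 z w₁ w₂ → Bal3 X (z , F z) (w₁ , G w₁) (w₂ , G w₂)

  mixed-at : ∀ (F G : Pair → C) {z w₁ w₂ u v} → Perm3 z w₁ w₂ → Perm3 z u v →
    Bal3 X (z , F z) (u , G u) (v , G v) → Bal3 X (z , F z) (w₁ , G w₁) (w₂ , G w₂)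
  mixed-at F G ρ σ B with perm3-rest ρ σ
  ... | inj₁ (refl , refl) = B
  ... | inj₂ (refl , refl) = bc-≐ {X} t132 B

  mixed-from-three : ∀ (F G : Pair → C) {a b c} → Perm3 a b c →
    Bal3 X (a , F a) (b , G b) (c , G c) → Bal3 X (b , F b) (a , G a) (c , G c) → Bal3 X (c , F c) (a , G a) (b , G b) →
    MixedBalanced F G
  mixed-from-three F G π Ba Bb Bc {z} ρ with perm3-distinct π | perm3-cover (perm3-distinct π) z
  ... | _ | inj₁ refl = mixed-at F G ρ π Ba
  ... | ab , bc , ac | inj₂ (inj₁ refl) = mixed-at F G ρ (perm3 (≢-sym ab , ac , bc)) Bb
  ... | ab , bc , ac | inj₂ (inj₂ refl) = mixed-at F G ρ (perm3 (≢-sym ac , ab , ≢-sym bc)) Bc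

  mixed-from-values : ∀ (F G : Pair → C) {a b c ua ub uc va vb vc} → Perm3 a b c →
    F a ≡ ua → F b ≡ ub → F c ≡ uc → G a ≡ va → G b ≡ vb → G c ≡ vc →
    Bal3 X (a , ua) (b , vb) (c , vc) → Bal3 X (b , ub) (a , va) (c , vc) → Bal3 X (c , uc) (a , va) (b , vb) →
    MixedBalanced F G
  mixed-from-values F G π Fa Fb Fc Ga Gb Gc Ba Bb Bc = mixed-from-three F G π
    (Bal3-cong (sym Fa) (sym Gb) (sym Gc) Ba) (Bal3-cong (sym Fb) (sym Ga) (sym Gc) Bb) (Bal3-cong (sym Fc) (sym Ga) (sym Gb) Bc)

  mixed-cong : ∀ {F F' G G'} → (∀ q → F q ≡ F' q) → (∀ q → G q ≡ G' q) → MixedBalanced F' G' → MixedBalanced F G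
  mixed-cong ef eg B {z} {w₁} {w₂} π = Bal3-cong (sym (ef z)) (sym (eg w₁)) (sym (eg w₂)) (B π)

  assign-self-mixed : ∀ {a b c u v w} → Perm3 a b c → Bal3 X (a , u) (b , v) (c , w) → MixedBalanced (assign a b u v w) (assign a b u v w)
  assign-self-mixed {a} {b} {c} {u} {v} {w} π B with assign-values {x = u} {v} {w} (perm3-distinct π)
  ... | Fa , Fb , Fc = mixed-from-values F F π Fa Fb Fc Fa Fb Fc B (bc-≐ {X} t213 B) (bc-≐ {X} t312 B)
    where
    F = assign a b u v w

-- The remaining case: #Q ≤ 2 and θ sends e₀ to a link P = g' e_p.  Lines of
-- L₀(Q K₃) through e₀ become lines through P, which forces the images of
-- h e12, h e23, h e13 (for each h ∈ Q) into one of a few patterns (View h).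
-- From the pattern of h we read off a triangle of Q', given by its labels
-- out h q at the classes q, through P or through the images of h; the map
-- h e_q ↦ (out h q) e_q is then an isotopic copy of Q inside Q'.  Since
-- equality in Q is not decidable, everything is argued element by element.

module ThroughLink (Q Q' : Quasigroup) (θ : L0Elem Q → L0Elem Q') (mono : IsMatroidMono Q Q' θ)
  (le2 : CardLe2 Q) (p : Pair) (g' : Carrier Q') (θe₀ : θ nothing ≡ just (p , g')) where
  open MatroidMono Q Q' θ mono
  open SmallQuasigroup Q le2
  open QuasigroupFacts Q' using (complete; complete-balanced; complete-unique)
  open Mixed Q'
  private
    C = Carrier Q
    C' = Carrier Q'
    _∙_ = _·_ Q

  P : L0Elem Q'
  P = just (p , g')

  t : Pair → C → L0Elem Q'
  t q h = θ (just (q , h))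

  P≢t : ∀ q h → P ≢ t q h
  P≢t q h e = θ-distinct (λ ()) (trans θe₀ e)

  t-classes : ∀ {q q' g h} → q ≢ q' → t q g ≢ t q' h
  t-classes n = link-distinct (λ e → n (cong proj₁ e))

  images-differ : ∀ {q q' g h u v} → q ≢ q' → t q g ≡ u → t q' h ≡ v → u ≢ v
  images-differ n e₁ e₂ = subst₂ _≢_ e₁ e₂ (t-classes n)

  t-labels : ∀ {q g h} → g ≢ h → t q g ≢ t q h
  t-labels n = link-distinct (λ e → n (cong proj₂ e))

  P-line : ∀ q g h → Rank3 Q' P (t q g) (t q h) 2
  P-line q g h = rank-cong θe₀ refl refl (preserve rank2-e₀)

  P-nonline : ∀ {q q'} g h → q ≢ q' → Rank3 Q' P (t q g) (t q' h) 3
  P-nonline g h n = rank-cong θe₀ refl refl (preserve (rank3-e₀ n))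

  image-line : ∀ {a b c x y z} → Perm3 a b c → x ∙ y ≡ z → Rank3 Q' (t a x) (t b y) (t c z) 2
  image-line π e = preserve (balanced⇒rank2 π (proj₂ (balanced-any-order π) e))

  idempotent-if-line : ∀ {a b c h} → Perm3 a b c → Rank3 Q' (t a h) (t b h) (t c h) 2 → h ∙ h ≡ h
  idempotent-if-line π R = proj₁ (balanced-any-order π) (rank2⇒balanced π (reflect R))

  nonidempotent-if-nonline : ∀ {a b c h} → Perm3 a b c → Rank3 Q' (t a h) (t b h) (t c h) 3 → h ∙ h ≢ h
  nonidempotent-if-nonline π R e = rank2≢3 (image-line π e) R

  two-e₀ : ∀ {q q' h} → q ≢ q' → t q h ≡ nothing → t q' h ≡ nothing → ⊥
  two-e₀ n e₁ e₂ = t-classes n (trans e₁ (sym e₂))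

  e₀-and-P : ∀ {q q' h x} → q ≢ q' → t q h ≡ nothing → t q' h ≡ just (p , x) → ⊥
  e₀-and-P {h = h} n e₁ e₂ = rank2≢3 (reorder t213 rank2-e₀) (rank-cong refl e₁ e₂ (P-nonline h h n))

  two-P : ∀ {q q' h x y} → q ≢ q' → t q h ≡ just (p , x) → t q' h ≡ just (p , y) → ⊥
  two-P {q} {h = h} n e₁ e₂ =
    rank2≢3 (rank2-parallel (values {Q'} (subst (P ≢_) e₁ (P≢t q h)))) (rank-cong refl e₁ e₂ (P-nonline h h n))

  off-P : ∀ {q q' h a x} → q ≢ q' → t q h ≡ nothing → t q' h ≡ just (a , x) → a ≢ p
  off-P n e₁ e₂ refl = e₀-and-P n e₁ e₂

  -- I:   one image is e₀, the other two are off class p, in one class (∥)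
  --       or in the two classes other than p (×);
  -- II:  one image is of class p, the other two as in I;
  -- III: all three images lie in one class s ≠ p.
  -- (Images all off class p in at least two classes are impossible.)
  data View (h : C) : Set where
    viewI∥ : (r a : Pair) (x y : C') → t r h ≡ nothing → t (next r) h ≡ just (a , x) → t (next (next r)) h ≡ just (a , y) →
             a ≢ p → View h
    viewI× : (r a b : Pair) (x y : C') → t r h ≡ nothing → t (next r) h ≡ just (a , x) → t (next (next r)) h ≡ just (b , y) →
             a ≢ p → b ≢ p → a ≢ b → View h
    viewII∥ : (r a : Pair) (x₀ x y : C') → t r h ≡ just (p , x₀) → t (next r) h ≡ just (a , x) → t (next (next r)) h ≡ just (a , y) →
              a ≢ p → View h
    viewII× : (r a b : Pair) (x₀ x y : C') → t r h ≡ just (p , x₀) → t (next r) h ≡ just (a , x) → t (next (next r)) h ≡ just (b , y) →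
              a ≢ p → b ≢ p → a ≢ b → View h
    viewIII : (s : Pair) (x y z : C') → t e12 h ≡ just (s , x) → t e23 h ≡ just (s , y) → t e13 h ≡ just (s , z) → s ≢ p → View h

  module _ {h : C} where
    viewI∥-idempotent : ∀ {r a x y} → t r h ≡ nothing → t (next r) h ≡ just (a , x) → t (next (next r)) h ≡ just (a , y) → h ∙ h ≡ h
    viewI∥-idempotent {r} e₁ e₂ e₃ = idempotent-if-line (next-perm r) (rank-cong (sym e₁) (sym e₂) (sym e₃) rank2-e₀)

    viewI×-nonidempotent : ∀ {r a b x y} → t r h ≡ nothing → t (next r) h ≡ just (a , x) → t (next (next r)) h ≡ just (b , y) →
      a ≢ b → h ∙ h ≢ h
    viewI×-nonidempotent {r} e₁ e₂ e₃ ab = nonidempotent-if-nonline (next-perm r) (rank-cong (sym e₁) (sym e₂) (sym e₃) (rank3-e₀ ab))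

    viewII∥-nonidempotent : ∀ {r a x₀ x y} → t r h ≡ just (p , x₀) → t (next r) h ≡ just (a , x) → t (next (next r)) h ≡ just (a , y) →
      a ≢ p → h ∙ h ≢ h
    viewII∥-nonidempotent {r} e₁ e₂ e₃ ap = nonidempotent-if-nonline (next-perm r)
      (rank-cong (sym e₁) (sym e₂) (sym e₃)
        (reorder t312 (rank3-digon (values {Q'} (images-differ (proj₁ (proj₂ (perm3-distinct (next-perm r)))) e₂ e₃)) ap)))

    viewIII-idempotent : ∀ {s x y z} → t e12 h ≡ just (s , x) → t e23 h ≡ just (s , y) → t e13 h ≡ just (s , z) → h ∙ h ≡ h
    viewIII-idempotent e₁ e₂ e₃ =
      idempotent-if-line p123 (rank-cong (sym e₁) (sym e₂) (sym e₃) (rank2-parallel (values {Q'} (images-differ (λ ()) e₁ e₂))))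

    -- for idempotent h the three images form a line, so their classes are all
    -- equal or all different
    idempotent-classes : ∀ {a b c x y z} → t e12 h ≡ just (a , x) → t e23 h ≡ just (b , y) → t e13 h ≡ just (c , z) →
      h ∙ h ≡ h → (a ≡ b × b ≡ c) ⊎ Distinct3 a b c
    idempotent-classes e₁ e₂ e₃ i =
      line-classes (images-differ (λ ()) e₁ e₂) (images-differ (λ ()) e₂ e₃) (images-differ (λ ()) e₁ e₃)
                   (rank-cong e₁ e₂ e₃ (image-line p123 i))

    scattered-nonidempotent : ∀ {a b c x y z} → t e12 h ≡ just (a , x) → t e23 h ≡ just (b , y) → t e13 h ≡ just (c , z) →
      a ≢ p → b ≢ p → c ≢ p → ¬ (a ≡ b × b ≡ c) → h ∙ h ≢ h
    scattered-nonidempotent e₁ e₂ e₃ ap bp cp ne i with idempotent-classes e₁ e₂ e₃ i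
    ... | inj₁ q = ne q
    ... | inj₂ d = no-fourth-class d ap bp cp

  P-line-e₀ : ∀ {b w} → Rank3 Q' P nothing (just (b , w)) 2 → b ≡ p
  P-line-e₀ R = sym (e₀-line⇒class (reorder t213 R))

  P-line-class-p : ∀ {x b w} → b ≢ p → P ≢ just (p , x) → Rank3 Q' P (just (p , x)) (just (b , w)) 2 → ⊥
  P-line-class-p bp n R = rank2≢3 R (rank3-digon (values {Q'} n) (≢-sym bp))

  partner-class : ∀ {q g h s v} → g ≢ h → t q h ≡ just (s , v) → s ≢ p → Σ C' λ w → t q g ≡ just (third p s , w)
  partner-class {q} {g} {h} gh eh sp with t q g in eg
  ... | nothing = ⊥-elim (sp (P-line-e₀ (rank-cong refl eg eh (P-line q g h))))
  ... | just (b , w) with b ≟P p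
  ...   | yes refl = ⊥-elim (P-line-class-p sp (subst (P ≢_) eg (P≢t q g)) (rank-cong refl eg eh (P-line q g h)))
  ...   | no bp with line-through-link bp sp (subst₂ _≢_ eg eh (t-labels gh)) (rank-cong refl eg eh (P-line q g h))
  ...     | bs , _ = w , cong (λ c → just (c , w)) (third-unique (≢-sym sp , ≢-sym bs , ≢-sym bp))

  partner : ∀ {q g h a b x y} → g ≢ h → t q g ≡ just (a , x) → t q h ≡ just (b , y) → a ≢ p → b ≢ p →
    b ≡ third p a × Bal3 Q' (p , g') (a , x) (b , y)
  partner {q} {g} {h} gh eg eh ap bp with line-through-link ap bp (subst₂ _≢_ eg eh (t-labels gh)) (rank-cong refl eg eh (P-line q g h))
  ... | ab , B = third-unique (≢-sym ap , ab , ≢-sym bp) , B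

  partner-sym : ∀ {a b} → a ≢ p → b ≡ third p a → a ≡ third p b
  partner-sym ap refl = sym (third-involutive (≢-sym ap))

  parallel-alone : ∀ {g h s x y z} → t e12 h ≡ just (s , x) → t e23 h ≡ just (s , y) → t e13 h ≡ just (s , z) → s ≢ p → g ≢ h → ⊥
  parallel-alone e₁ e₂ e₃ sp gh with partner-class gh e₁ sp | partner-class gh e₂ sp | partner-class gh e₃ sp
  ... | _ , f₁ | _ , f₂ | _ , f₃ = gh (idempotent-unique (viewIII-idempotent f₁ f₂ f₃) (viewIII-idempotent e₁ e₂ e₃))

  scattered-alone : ∀ {g h a b c x y z} → t e12 h ≡ just (a , x) → t e23 h ≡ just (b , y) → t e13 h ≡ just (c , z) →
    a ≢ p → b ≢ p → c ≢ p → ¬ (a ≡ b × b ≡ c) → g ≢ h → ⊥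
  scattered-alone e₁ e₂ e₃ ap bp cp ne gh with idempotent-split gh
  ... | inj₂ (hi , _) = scattered-nonidempotent e₁ e₂ e₃ ap bp cp ne hi
  ... | inj₁ (gi , _) with partner-class gh e₁ ap | partner-class gh e₂ bp | partner-class gh e₃ cp
  ...   | _ , f₁ | _ , f₂ | _ , f₃ with idempotent-classes f₁ f₂ f₃ gi
  ...     | inj₁ (q₁ , q₂) = ne (third-injective (≢-sym ap) (≢-sym bp) q₁ , third-injective (≢-sym bp) (≢-sym cp) q₂)
  ...     | inj₂ d = no-fourth-class d (third-≢ˡ (≢-sym ap)) (third-≢ˡ (≢-sym bp)) (third-≢ˡ (≢-sym cp))

  scattered-impossible : ∀ {h a b c x y z} → t e12 h ≡ just (a , x) → t e23 h ≡ just (b , y) → t e13 h ≡ just (c , z) →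
    a ≢ p → b ≢ p → c ≢ p → ¬ (a ≡ b × b ≡ c) → ⊥
  scattered-impossible e₁ e₂ e₃ ap bp cp ne = scattered-alone e₁ e₂ e₃ ap bp cp ne (scattered-nonidempotent e₁ e₂ e₃ ap bp cp ne)

  e₀-position : ∀ {g h rg rh ah bh x₀ xh yh} → t rg g ≡ nothing →
    t rh h ≡ just (p , x₀) → t (next rh) h ≡ just (ah , xh) → t (next (next rh)) h ≡ just (bh , yh) → ah ≢ p → bh ≢ p → rg ≡ rh
  e₀-position {g} {h} {rg} {rh} eg e₁ e₂ e₃ ap bp with perm3-cover (perm3-distinct (next-perm rh)) rg
  ... | inj₁ e = e
  ... | inj₂ (inj₁ refl) = ⊥-elim (ap (P-line-e₀ (rank-cong refl eg e₂ (P-line (next rh) g h))))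
  ... | inj₂ (inj₂ refl) = ⊥-elim (bp (P-line-e₀ (rank-cong refl eg e₃ (P-line (next (next rh)) g h))))

  p-position : ∀ {g h rg rh x₀g ah bh x₀ xh yh} → t rg g ≡ just (p , x₀g) →
    t rh h ≡ just (p , x₀) → t (next rh) h ≡ just (ah , xh) → t (next (next rh)) h ≡ just (bh , yh) → ah ≢ p → bh ≢ p → rg ≡ rh
  p-position {g} {h} {rg} {rh} eg e₁ e₂ e₃ ap bp with perm3-cover (perm3-distinct (next-perm rh)) rg
  ... | inj₁ e = e
  ... | inj₂ (inj₁ refl) = ⊥-elim (P-line-class-p ap (subst (P ≢_) eg (P≢t _ g)) (rank-cong refl eg e₂ (P-line (next rh) g h)))
  ... | inj₂ (inj₂ refl) = ⊥-elim (P-line-class-p bp (subst (P ≢_) eg (P≢t _ g)) (rank-cong refl eg e₃ (P-line (next (next rh)) g h)))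

  -- two distinct elements cannot both be of view II: with c = n·n the mixed
  -- triangles (c, n, n) and (n, c, n) would be lines of impossible classes
  private
    viewII-pair-square : ∀ {r c n ac bc an bn x₀c xc yc x₀n xn yn} →
      t r c ≡ just (p , x₀c) → t (next r) c ≡ just (ac , xc) → t (next (next r)) c ≡ just (bc , yc) → ac ≢ p → bc ≢ p →
      t r n ≡ just (p , x₀n) → t (next r) n ≡ just (an , xn) → t (next (next r)) n ≡ just (bn , yn) →
      an ≡ third p ac → bn ≡ third p bc → n ∙ n ≡ c → ⊥
    viewII-pair-square {r} {c} {n} {ac} {bc} c₁ c₂ c₃ acp bcp n₁ n₂ n₃ ea eb nn
      with line-classes (images-differ r≢r₁ c₁ n₂) (images-differ r₁≢r₂ n₂ n₃) (images-differ r≢r₂ c₁ n₃)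
                        (rank-cong c₁ n₂ n₃ (image-line (next-perm r) (swap₁₃ nn)))
         | line-classes (images-differ r≢r₁ n₁ c₂) (images-differ r₁≢r₂ c₂ n₃) (images-differ r≢r₂ n₁ n₃)
                        (rank-cong n₁ c₂ n₃ (image-line (next-perm r) (swap₂₃ nn)))
      where
      r≢r₁ = proj₁ (perm3-distinct (next-perm r))
      r₁≢r₂ = proj₁ (proj₂ (perm3-distinct (next-perm r)))
      r≢r₂ = proj₂ (proj₂ (perm3-distinct (next-perm r)))
    ... | inj₁ (e , _) | _ = third-≢ˡ (≢-sym acp) (sym (trans e ea))
    ... | inj₂ _ | inj₁ (e , _) = acp (sym e)
    ... | inj₂ (_ , anbn , _) | inj₂ (_ , acbn , _) with ac ≟P bc
    ...   | yes refl = anbn (trans ea (sym eb))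
    ...   | no acbc = acbn (sym (trans eb (trans (cong (third p) (third-unique (≢-sym acp , acbc , ≢-sym bcp))) (third-involutive (≢-sym acp)))))

  viewII-pair : ∀ {g h rg ag bg x₀g xg yg rh ah bh x₀h xh yh} → g ≢ h →
    t rg g ≡ just (p , x₀g) → t (next rg) g ≡ just (ag , xg) → t (next (next rg)) g ≡ just (bg , yg) → ag ≢ p → bg ≢ p →
    t rh h ≡ just (p , x₀h) → t (next rh) h ≡ just (ah , xh) → t (next (next rh)) h ≡ just (bh , yh) → ah ≢ p → bh ≢ p → ⊥
  viewII-pair gh g₁ g₂ g₃ agp bgp h₁ h₂ h₃ ahp bhp with p-position g₁ h₁ h₂ h₃ ahp bhp
  ... | refl with partner gh g₂ h₂ agp ahp | partner gh g₃ h₃ bgp bhp | idempotent-split gh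
  ...   | ea , _ | eb , _ | inj₁ (_ , hh) = viewII-pair-square g₁ g₂ g₃ agp bgp h₁ h₂ h₃ ea eb hh
  ...   | ea , _ | eb , _ | inj₂ (_ , gg) = viewII-pair-square h₁ h₂ h₃ ahp bhp g₁ g₂ g₃ (partner-sym agp ea) (partner-sym bgp eb) gg

  private
    viewI : ∀ {h} r a b x y → t r h ≡ nothing → t (next r) h ≡ just (a , x) → t (next (next r)) h ≡ just (b , y) →
      a ≢ p → b ≢ p → View h
    viewI r a b x y e₁ e₂ e₃ ap bp with a ≟P b
    ... | yes refl = viewI∥ r a x y e₁ e₂ e₃ ap
    ... | no ab = viewI× r a b x y e₁ e₂ e₃ ap bp ab

    viewII : ∀ {h} r a b x₀ x y → t r h ≡ just (p , x₀) → t (next r) h ≡ just (a , x) → t (next (next r)) h ≡ just (b , y) →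
      a ≢ p → b ≢ p → View h
    viewII r a b x₀ x y e₁ e₂ e₃ ap bp with a ≟P b
    ... | yes refl = viewII∥ r a x₀ x y e₁ e₂ e₃ ap
    ... | no ab = viewII× r a b x₀ x y e₁ e₂ e₃ ap bp ab

    links-view : ∀ h a b c x y z → t e12 h ≡ just (a , x) → t e23 h ≡ just (b , y) → t e13 h ≡ just (c , z) → View h
    links-view h a b c x y z e₁ e₂ e₃ with a ≟P p | b ≟P p | c ≟P p
    ... | yes refl | yes refl | _ = ⊥-elim (two-P {e12} {e23} (λ ()) e₁ e₂)
    ... | yes refl | no _ | yes refl = ⊥-elim (two-P {e12} {e13} (λ ()) e₁ e₃)
    ... | no _ | yes refl | yes refl = ⊥-elim (two-P {e23} {e13} (λ ()) e₂ e₃)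
    ... | yes refl | no bp | no cp = viewII e12 b c x y z e₁ e₂ e₃ bp cp
    ... | no ap | yes refl | no cp = viewII e23 c a y z x e₂ e₃ e₁ cp ap
    ... | no ap | no bp | yes refl = viewII e13 a b z x y e₃ e₁ e₂ ap bp
    ... | no ap | no bp | no cp with a ≟P b | b ≟P c
    ...   | yes refl | yes refl = viewIII a x y z e₁ e₂ e₃ ap
    ...   | yes refl | no n = ⊥-elim (scattered-impossible e₁ e₂ e₃ ap bp cp (λ q → n (proj₂ q)))
    ...   | no n | _ = ⊥-elim (scattered-impossible e₁ e₂ e₃ ap bp cp (λ q → n (proj₁ q)))

  view : ∀ h → View h
  view h with t e12 h in e₁ | t e23 h in e₂ | t e13 h in e₃
  ... | nothing | nothing | _ = ⊥-elim (two-e₀ {e12} {e23} (λ ()) e₁ e₂)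
  ... | nothing | just _ | nothing = ⊥-elim (two-e₀ {e12} {e13} (λ ()) e₁ e₃)
  ... | just _ | nothing | nothing = ⊥-elim (two-e₀ {e23} {e13} (λ ()) e₂ e₃)
  ... | nothing | just (a , x) | just (b , y) = viewI e12 a b x y e₁ e₂ e₃ (off-P {e12} {e23} (λ ()) e₁ e₂) (off-P {e12} {e13} (λ ()) e₁ e₃)
  ... | just (b , y) | nothing | just (a , x) = viewI e23 a b x y e₂ e₃ e₁ (off-P {e23} {e13} (λ ()) e₂ e₃) (off-P {e23} {e12} (λ ()) e₂ e₁)
  ... | just (a , x) | just (b , y) | nothing = viewI e13 a b x y e₃ e₁ e₂ (off-P {e13} {e12} (λ ()) e₃ e₁) (off-P {e13} {e23} (λ ()) e₃ e₂)
  ... | just (a , x) | just (b , y) | just (c , z) = links-view h a b c x y z e₁ e₂ e₃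

  -- In views I and II it passes
  -- through P, resp. through the class-p image of h, and through the images
  -- off class p (or, when these are parallel, through the second one); in
  -- view III it is completed from the labels of two images.
  outIII : Pair → C' → Pair → C'
  outIII s x = assign p s (complete s x (third p s) x) x x

  outOf : ∀ {h} → View h → Pair → C'
  outOf (viewI∥ _ a _ y _ _ _ _) = assign p a g' y (complete p g' a y)
  outOf (viewI× _ a _ x y _ _ _ _ _ _) = assign p a g' x y
  outOf (viewII∥ _ a x₀ x _ _ _ _ _) = assign p a x₀ x (complete p g' a x)
  outOf (viewII× _ a _ x₀ x y _ _ _ _ _ _) = assign p a x₀ x y
  outOf (viewIII s x _ _ _ _ _ _) = outIII s x

  outI∥-mixed : ∀ a y → a ≢ p → MixedBalanced (assign p a g' y (complete p g' a y)) (assign p a g' y (complete p g' a y))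
  outI∥-mixed a y ap = assign-self-mixed (third-perm (≢-sym ap)) (complete-balanced g' y (≢-sym ap))

  outIII-mixed : ∀ s x → s ≢ p → MixedBalanced (outIII s x) (outIII s x)
  outIII-mixed s x sp = assign-self-mixed (perm3 (≢-sym sp , s≢m , ≢-sym (third-≢ˡ (≢-sym sp))))
    (bc-≐ {Q'} t312 (subst (λ c → Bal3 Q' (s , x) (m , x) (c , complete s x m x)) third≡p (complete-balanced x x s≢m)))
    where
    m = third p s
    s≢m : s ≢ m
    s≢m = ≢-sym (third-≢ʳ (≢-sym sp))
    third≡p : third s m ≡ p
    third≡p = sym (third-unique (s≢m , third-≢ˡ (≢-sym sp) , sp))

  -- Mixing the triangle of c = g·g at one class with that of g at the two
  -- others gives the images of balanced triangles (c, g, g), (g, c, g) and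
  -- (g, g, c), which are balanced once they have three classes.
  image-balanced : ∀ {r X Y Z c₁ c₂ c₃ x₁ x₂ x₃} → X ∙ Y ≡ Z →
    t r X ≡ just (c₁ , x₁) → t (next r) Y ≡ just (c₂ , x₂) → t (next (next r)) Z ≡ just (c₃ , x₃) →
    Distinct3 c₁ c₂ c₃ → Bal3 Q' (c₁ , x₁) (c₂ , x₂) (c₃ , x₃)
  image-balanced {r} rel e₁ e₂ e₃ d = rank2⇒balanced (perm3 d) (rank-cong e₁ e₂ e₃ (image-line (next-perm r) rel))

  mixed-I-II : ∀ {r g c ag bg xg yg x₀c xc yc} → g ∙ g ≡ c →
    t (next r) g ≡ just (ag , xg) → t (next (next r)) g ≡ just (bg , yg) → ag ≢ p → bg ≢ p → ag ≢ bg →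
    t r c ≡ just (p , x₀c) → t (next r) c ≡ just (bg , xc) → t (next (next r)) c ≡ just (ag , yc) →
    Bal3 Q' (p , g') (ag , xg) (bg , xc) → Bal3 Q' (p , g') (bg , yg) (ag , yc) →
    MixedBalanced (assign p bg x₀c xc yc) (assign p ag g' xg yg)
  mixed-I-II {ag = ag} {bg} {xg} {yg} {x₀c} {xc} {yc} cg g₂ g₃ agp bgp agbg c₁ c₂ c₃ Ba Bb =
    mixed-from-values (assign p bg x₀c xc yc) (assign p ag g' xg yg) (perm3 dG)
      (proj₁ Fvalues) (proj₂ (proj₂ Fvalues)) (proj₁ (proj₂ Fvalues)) (proj₁ Gvalues) (proj₁ (proj₂ Gvalues)) (proj₂ (proj₂ Gvalues))
      (image-balanced (swap₁₃ cg) c₁ g₂ g₃ dG) (bc-≐ {Q'} t312 Bb) (bc-≐ {Q'} t312 Ba)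
    where
    dG : Distinct3 p ag bg
    dG = ≢-sym agp , agbg , ≢-sym bgp
    Fvalues = assign-values {x = x₀c} {xc} {yc} (distinct-swap₂₃ dG)
    Gvalues = assign-values {x = g'} {xg} {yg} dG

  mixed-I∥-II∥ : ∀ {r g c sc sg xc yc x₀g xg yg} → sg ≡ third p sc → g ∙ g ≡ c → sc ≢ p →
    t (next r) c ≡ just (sc , xc) → t (next (next r)) c ≡ just (sc , yc) →
    t r g ≡ just (p , x₀g) → t (next r) g ≡ just (sg , xg) → t (next (next r)) g ≡ just (sg , yg) →
    Bal3 Q' (p , g') (sc , xc) (sg , xg) → Bal3 Q' (p , g') (sc , yc) (sg , yg) →
    MixedBalanced (assign p sc g' yc (complete p g' sc yc)) (assign p sg x₀g xg (complete p g' sg xg))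
  mixed-I∥-II∥ {sc = sc} {xc = xc} {yc} {x₀g} {xg} {yg} refl cg scp c₂ c₃ g₁ g₂ g₃ Bx By =
    mixed-from-values F G (perm3 dF) Fp Fc (trans Fg (sym yg≡)) Gp (trans Gsc (sym xc≡)) Gg
      Bx (bc-≐ {Q'} t312 (image-balanced cg g₁ g₂ c₃ (distinct-swap₂₃ dF))) (bc-≐ {Q'} t312 (image-balanced (swap₂₃ cg) g₁ c₂ g₃ dF))
    where
    sg = third p sc
    F = assign p sc g' yc (complete p g' sc yc)
    G = assign p sg x₀g xg (complete p g' sg xg)
    dF : Distinct3 p sc sg
    dF = third-distinct (≢-sym scp)
    Fvalues = assign-values {x = g'} {yc} {complete p g' sc yc} dF
    Fp = proj₁ Fvalues
    Fc = proj₁ (proj₂ Fvalues)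
    Fg = proj₂ (proj₂ Fvalues)
    Gvalues = assign-values {x = x₀g} {xg} {complete p g' sg xg} (third-distinct (≢-sym (third-≢ˡ (≢-sym scp))))
    Gp = proj₁ Gvalues
    Gg = proj₁ (proj₂ Gvalues)
    Gsc : G sc ≡ complete p g' sg xg
    Gsc = subst (λ q → G q ≡ complete p g' sg xg) (third-involutive (≢-sym scp)) (proj₂ (proj₂ Gvalues))
    yg≡ : yg ≡ complete p g' sc yc
    yg≡ = complete-unique (perm3 dF) By
    xc≡ : xc ≡ complete p g' sg xg
    xc≡ = complete-unique (perm3 (distinct-swap₂₃ dF)) (bc-≐ {Q'} t132 Bx)

  mixed-II-II : ∀ {r g c a b x₀g xg yg x₀c xc yc} → g ∙ g ≡ c → Distinct3 p a b →
    t r g ≡ just (p , x₀g) → t (next r) g ≡ just (a , xg) → t (next (next r)) g ≡ just (b , yg) →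
    t r c ≡ just (p , x₀c) → t (next r) c ≡ just (a , xc) → t (next (next r)) c ≡ just (b , yc) →
    MixedBalanced (assign p a x₀c xc yc) (assign p a x₀g xg yg)
  mixed-II-II {x₀g = x₀g} {xg} {yg} {x₀c} {xc} {yc} cg d g₁ g₂ g₃ c₁ c₂ c₃ =
    mixed-from-values (assign p _ x₀c xc yc) (assign p _ x₀g xg yg) (perm3 d)
      (proj₁ Fvalues) (proj₁ (proj₂ Fvalues)) (proj₂ (proj₂ Fvalues)) (proj₁ Gvalues) (proj₁ (proj₂ Gvalues)) (proj₂ (proj₂ Gvalues))
      (image-balanced (swap₁₃ cg) c₁ g₂ g₃ d) (bc-≐ {Q'} t213 (image-balanced (swap₂₃ cg) g₁ c₂ g₃ d))
      (bc-≐ {Q'} t312 (image-balanced cg g₁ g₂ c₃ d))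
    where
    Fvalues = assign-values {x = x₀c} {xc} {yc} d
    Gvalues = assign-values {x = x₀g} {xg} {yg} d

  square-of-I× : ∀ {r g c ag bg xg yg ac bc x₀c xc yc} → g ∙ g ≡ c → g ≢ c →
    t (next r) g ≡ just (ag , xg) → t (next (next r)) g ≡ just (bg , yg) → ag ≢ p → bg ≢ p → ag ≢ bg →
    t r c ≡ just (p , x₀c) → t (next r) c ≡ just (ac , xc) → t (next (next r)) c ≡ just (bc , yc) → ac ≢ p → bc ≢ p →
    MixedBalanced (assign p ac x₀c xc yc) (assign p ag g' xg yg)
  square-of-I× cg g≢c g₂ g₃ agp bgp agbg c₁ c₂ c₃ acp bcp
    with partner g≢c g₂ c₂ agp acp | partner g≢c g₃ c₃ bgp bcp
       | third-unique (≢-sym agp , agbg , ≢-sym bgp) | third-unique (≢-sym bgp , ≢-sym agbg , ≢-sym agp)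
  ... | ea , Ba | eb , Bb | bg≡ | ag≡ rewrite ea | eb | sym bg≡ | sym ag≡ = mixed-I-II cg g₂ g₃ agp bgp agbg c₁ c₂ c₃ Ba Bb

  -- Elements with views of different kinds, or of the same kind but with
  -- different positions or classes, are different.
  data Kind : Set where
    kindI kindII kindIII : Kind

  kind : ∀ {h} → View h → Kind
  kind (viewI∥ _ _ _ _ _ _ _ _) = kindI
  kind (viewI× _ _ _ _ _ _ _ _ _ _ _) = kindI
  kind (viewII∥ _ _ _ _ _ _ _ _ _) = kindII
  kind (viewII× _ _ _ _ _ _ _ _ _ _ _ _) = kindII
  kind (viewIII _ _ _ _ _ _ _ _) = kindIII

  shape : ∀ {h} → View h → Pair × Pair × Pair
  shape (viewI∥ r a _ _ _ _ _ _) = r , a , a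
  shape (viewI× r a b _ _ _ _ _ _ _ _) = r , a , b
  shape (viewII∥ r a _ _ _ _ _ _ _) = r , a , a
  shape (viewII× r a b _ _ _ _ _ _ _ _ _) = r , a , b
  shape (viewIII s _ _ _ _ _ _ _) = s , s , s

  views-differ : ∀ {A : Set} (f : ∀ {h} → View h → A) {g c} {vg : View g} {vc : View c} →
    view g ≡ vg → view c ≡ vc → f vg ≢ f vc → g ≢ c
  views-differ f eg ec n refl = n (trans (cong f (sym eg)) (cong f ec))

  same-view-out : ∀ {g c} {vg : View g} {vc : View c} → view g ≡ vg → view c ≡ vc → g ≡ c → ∀ q → outOf vg q ≡ outOf vc q
  same-view-out eg ec refl q = cong (λ v → outOf v q) (trans (sym eg) ec)

  -- Where the label of out h at class p comes from: P itself (view I), the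
  -- class-p image of h (view II), or h is the only element of Q (view III).
  data PLabel (h : C) (x : C') : Set where
    via-e₀ : ∀ r → t r h ≡ nothing → x ≡ g' → PLabel h x
    via-p : ∀ r → t r h ≡ just (p , x) → PLabel h x
    alone : ∀ s → s ≢ p → (∀ q → Σ C' λ y → t q h ≡ just (s , y)) → h ∙ h ≡ h → (∀ {g} → g ≢ h → ⊥) → PLabel h x

  pLabel : ∀ {h} (v : View h) → PLabel h (outOf v p)
  pLabel (viewI∥ r a _ _ e₁ _ _ _) = via-e₀ r e₁ (assign-first p a)
  pLabel (viewI× r a _ _ _ e₁ _ _ _ _ _) = via-e₀ r e₁ (assign-first p a)
  pLabel {h} (viewII∥ r a x₀ _ _ e₁ _ _ _) = via-p r (subst (λ w → t r h ≡ just (p , w)) (sym (assign-first p a)) e₁)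
  pLabel {h} (viewII× r a _ x₀ _ _ e₁ _ _ _ _ _) = via-p r (subst (λ w → t r h ≡ just (p , w)) (sym (assign-first p a)) e₁)
  pLabel (viewIII s x y z e₁ e₂ e₃ sp) = alone s sp images (viewIII-idempotent e₁ e₂ e₃) (parallel-alone e₁ e₂ e₃ sp)
    where
    images : ∀ q → Σ C' λ w → _ ≡ just (s , w)
    images e12 = x , e₁
    images e23 = y , e₂
    images e13 = z , e₃

  private
    alone-off-Lp : ∀ {g h s r} → s ≢ p → (∀ q → Σ C' λ y → t q g ≡ just (s , y)) → (∀ {g'} → g' ≢ g → ⊥) →
      OnClassLine {Q'} p (t r h) → ⊥
    alone-off-Lp {g} {h} {s} {r} sp images solo onLine = solo λ hg → clash onLine (subst (λ w → Σ C' λ y → t r w ≡ just (s , y)) (sym hg) (images r))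
      where
      clash : OnClassLine {Q'} p (t r h) → Σ C' (λ y → t r h ≡ just (s , y)) → ⊥
      clash (inj₁ e) (_ , e') with trans (sym e) e'
      ... | ()
      clash (inj₂ (_ , e)) (_ , e') = sp (sym (cong proj₁ (just-injective (trans (sym e) e'))))

  plabel-injective : ∀ {g h x} → PLabel g x → PLabel h x → g ≡ h
  plabel-injective (via-e₀ r e _) (via-e₀ r' e' _) = cong proj₂ (just-injective (θ-inj (trans e (sym e'))))
  plabel-injective {h = h} (via-e₀ _ _ x≡g') (via-p r e) = ⊥-elim (P≢t r h (trans (cong (λ w → just (p , w)) (sym x≡g')) (sym e)))
  plabel-injective {g} (via-p r e) (via-e₀ _ _ x≡g') = ⊥-elim (P≢t r g (trans (cong (λ w → just (p , w)) (sym x≡g')) (sym e)))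
  plabel-injective (via-p r e) (via-p r' e') = cong proj₂ (just-injective (θ-inj (trans e (sym e'))))
  plabel-injective (alone _ _ _ ig _) (alone _ _ _ ih _) = idempotent-unique ig ih
  plabel-injective (alone _ sp images _ solo) (via-e₀ _ e _) = ⊥-elim (alone-off-Lp sp images solo (inj₁ e))
  plabel-injective (alone _ sp images _ solo) (via-p _ e) = ⊥-elim (alone-off-Lp sp images solo (inj₂ (_ , e)))
  plabel-injective (via-e₀ _ e _) (alone _ sp images _ solo) = ⊥-elim (alone-off-Lp sp images solo (inj₁ e))
  plabel-injective (via-p _ e) (alone _ sp images _ solo) = ⊥-elim (alone-off-Lp sp images solo (inj₂ (_ , e)))

  -- Since
  -- c is idempotent, c has view I∥, II× or III (one lemma each); g either
  -- equals c or has a view matching that of c, as in the lemmas on mixed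
  -- triangles above.
  module Square {g c : C} (cg : g ∙ g ≡ c) where
    c-idempotent : c ∙ c ≡ c
    c-idempotent = subst (λ w → w ∙ w ≡ w) cg (square-idempotent g)

    other-kind : ∀ {vg : View g} {vc : View c} → view g ≡ vg → view c ≡ vc → kind vg ≢ kind vc → g ∙ g ≡ g → ⊥
    other-kind eg ec n i = views-differ kind eg ec n (idempotent-unique i c-idempotent)

    same-e₀ : ∀ {r r'} → t r g ≡ nothing → t r' c ≡ nothing → g ≡ c
    same-e₀ g₁ c₁ = cong proj₂ (just-injective (θ-inj (trans g₁ (sym c₁))))

    of-viewI∥ : ∀ (vg : View g) {rc ac xc yc c₁ c₂ c₃ acp} → view g ≡ vg → view c ≡ viewI∥ rc ac xc yc c₁ c₂ c₃ acp →
      MixedBalanced (assign p ac g' yc (complete p g' ac yc)) (outOf vg)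
    of-viewI∥ (viewI∥ _ _ _ _ g₁ _ _ _) {ac = ac} {yc = yc} {c₁} {acp = acp} eg ec =
      mixed-cong (λ _ → refl) (same-view-out eg ec (same-e₀ g₁ c₁)) (outI∥-mixed ac yc acp)
    of-viewI∥ (viewI× _ _ _ _ _ g₁ _ _ _ _ _) {ac = ac} {yc = yc} {c₁} {acp = acp} eg ec =
      mixed-cong (λ _ → refl) (same-view-out eg ec (same-e₀ g₁ c₁)) (outI∥-mixed ac yc acp)
    of-viewI∥ (viewII∥ _ _ _ _ _ g₁ g₂ g₃ agp) {c₁ = c₁} {c₂} {c₃} {acp} eg ec with e₀-position c₁ g₁ g₂ g₃ agp agp
    ... | refl = mixed-I∥-II∥ (proj₁ (partner c≢g c₂ g₂ acp agp)) cg acp c₂ c₃ g₁ g₂ g₃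
                   (proj₂ (partner c≢g c₂ g₂ acp agp)) (proj₂ (partner c≢g c₃ g₃ acp agp))
      where
      c≢g : c ≢ g
      c≢g = ≢-sym (views-differ kind eg ec λ ())
    of-viewI∥ (viewII× _ _ _ _ _ _ g₁ g₂ g₃ agp bgp agbg) {c₁ = c₁} {c₂} {c₃} {acp} eg ec with e₀-position c₁ g₁ g₂ g₃ agp bgp
    ... | refl = ⊥-elim (agbg (trans (proj₁ (partner c≢g c₂ g₂ acp agp)) (sym (proj₁ (partner c≢g c₃ g₃ acp bgp)))))
      where
      c≢g : c ≢ g
      c≢g = ≢-sym (views-differ kind eg ec λ ())
    of-viewI∥ (viewIII _ _ _ _ g₁ g₂ g₃ _) eg ec = ⊥-elim (other-kind eg ec (λ ()) (viewIII-idempotent g₁ g₂ g₃))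

    of-viewII× : ∀ (vg : View g) {rc ac bc x₀c xc yc c₁ c₂ c₃ acp bcp acbc} →
      view g ≡ vg → view c ≡ viewII× rc ac bc x₀c xc yc c₁ c₂ c₃ acp bcp acbc → MixedBalanced (assign p ac x₀c xc yc) (outOf vg)
    of-viewII× (viewI∥ _ _ _ _ g₁ g₂ g₃ _) eg ec = ⊥-elim (other-kind eg ec (λ ()) (viewI∥-idempotent g₁ g₂ g₃))
    of-viewII× (viewI× _ _ _ _ _ g₁ g₂ g₃ agp bgp agbg) {c₁ = c₁} {c₂} {c₃} {acp} {bcp} eg ec with e₀-position g₁ c₁ c₂ c₃ acp bcp
    ... | refl = square-of-I× cg (views-differ kind eg ec λ ()) g₂ g₃ agp bgp agbg c₁ c₂ c₃ acp bcp
    of-viewII× (viewII∥ _ _ _ _ _ g₁ g₂ g₃ agp) {c₁ = c₁} {c₂} {c₃} {acp} {bcp} {acbc} eg ec =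
      ⊥-elim (viewII-pair (views-differ shape eg ec λ e → acbc (trans (sym (cong (proj₁ ∘ proj₂) e)) (cong (proj₂ ∘ proj₂) e)))
                          g₁ g₂ g₃ agp agp c₁ c₂ c₃ acp bcp)
    of-viewII× (viewII× rg ag bg _ _ _ g₁ g₂ g₃ agp bgp agbg) {rc} {ac} {bc} {c₁ = c₁} {c₂} {c₃} {acp} {bcp} eg ec
      with rg ≟P rc | ag ≟P ac | bg ≟P bc
    ... | yes refl | yes refl | yes refl = mixed-II-II cg (≢-sym agp , agbg , ≢-sym bgp) g₁ g₂ g₃ c₁ c₂ c₃
    ... | no n | _ | _ = ⊥-elim (viewII-pair (views-differ shape eg ec λ e → n (cong proj₁ e)) g₁ g₂ g₃ agp bgp c₁ c₂ c₃ acp bcp)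
    ... | yes _ | no n | _ = ⊥-elim (viewII-pair (views-differ shape eg ec λ e → n (cong (proj₁ ∘ proj₂) e)) g₁ g₂ g₃ agp bgp c₁ c₂ c₃ acp bcp)
    ... | yes _ | yes _ | no n = ⊥-elim (viewII-pair (views-differ shape eg ec λ e → n (cong (proj₂ ∘ proj₂) e)) g₁ g₂ g₃ agp bgp c₁ c₂ c₃ acp bcp)
    of-viewII× (viewIII _ _ _ _ g₁ g₂ g₃ _) eg ec = ⊥-elim (other-kind eg ec (λ ()) (viewIII-idempotent g₁ g₂ g₃))

    of-viewIII : ∀ (vg : View g) {sc xc yc zc c₁ c₂ c₃ scp} → view g ≡ vg → view c ≡ viewIII sc xc yc zc c₁ c₂ c₃ scp →
      MixedBalanced (outIII sc xc) (outOf vg)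
    of-viewIII (viewIII _ _ _ _ g₁ g₂ g₃ _) {sc} {xc} {scp = scp} eg ec =
      mixed-cong (λ _ → refl) (same-view-out eg ec (idempotent-unique (viewIII-idempotent g₁ g₂ g₃) c-idempotent)) (outIII-mixed sc xc scp)
    of-viewIII (viewI∥ _ _ _ _ _ _ _ _) {c₁ = c₁} {c₂} {c₃} {scp} eg ec = ⊥-elim (parallel-alone c₁ c₂ c₃ scp (views-differ kind eg ec λ ()))
    of-viewIII (viewI× _ _ _ _ _ _ _ _ _ _ _) {c₁ = c₁} {c₂} {c₃} {scp} eg ec = ⊥-elim (parallel-alone c₁ c₂ c₃ scp (views-differ kind eg ec λ ()))
    of-viewIII (viewII∥ _ _ _ _ _ _ _ _ _) {c₁ = c₁} {c₂} {c₃} {scp} eg ec = ⊥-elim (parallel-alone c₁ c₂ c₃ scp (views-differ kind eg ec λ ()))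
    of-viewIII (viewII× _ _ _ _ _ _ _ _ _ _ _ _) {c₁ = c₁} {c₂} {c₃} {scp} eg ec = ⊥-elim (parallel-alone c₁ c₂ c₃ scp (views-differ kind eg ec λ ()))

  square-mixed : ∀ {g c} → g ∙ g ≡ c → (vg : View g) (vc : View c) → view g ≡ vg → view c ≡ vc → MixedBalanced (outOf vc) (outOf vg)
  square-mixed cg vg (viewI∥ _ _ _ _ _ _ _ _) eg ec = Square.of-viewI∥ cg vg eg ec
  square-mixed cg vg (viewII× _ _ _ _ _ _ _ _ _ _ _ _) eg ec = Square.of-viewII× cg vg eg ec
  square-mixed cg vg (viewIII _ _ _ _ _ _ _ _) eg ec = Square.of-viewIII cg vg eg ec
  square-mixed cg _ (viewI× _ _ _ _ _ c₁ c₂ c₃ _ _ acbc) _ _ = ⊥-elim (viewI×-nonidempotent c₁ c₂ c₃ acbc (Square.c-idempotent cg))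
  square-mixed cg _ (viewII∥ _ _ _ _ _ c₁ c₂ c₃ acp) _ _ = ⊥-elim (viewII∥-nonidempotent c₁ c₂ c₃ acp (Square.c-idempotent cg))

  -- The isotopic copy of Q: h e_q ↦ (out h q) e_q.
  out : C → Pair → C'
  out h = outOf (view h)

  -- h ↦ out h p is injective (by the origin of the label), hence so is
  -- h ↦ out h q for every class q: u = g // g and u' = g // h have the same
  -- label at p, as completions of the same two labels, so u·g = g = u·h
  out-p-injective : ∀ g h → out g p ≡ out h p → g ≡ h
  out-p-injective g h e = plabel-injective (pLabel (view g)) (subst (PLabel h) (sym e) (pLabel (view h)))

  out-square : ∀ g → MixedBalanced (out (g ∙ g)) (out g)
  out-square g = square-mixed refl (view g) (view (g ∙ g)) refl refl

  -- for #Q ≤ 2 every relation x·y = k has two equal entries, so its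
  -- triangle is a mixed triangle of a square
  out-balanced : ∀ {a b c} → Perm3 a b c → ∀ {x y k} → x ∙ y ≡ k → Bal3 Q' (a , out x a) (b , out y b) (c , out k c)
  out-balanced {a} {b} {c} π {x} {y} {k} e with perm3-distinct π | le2 x y k
  ... | ab , bc , ac | inj₁ refl =
    subst (λ w → Bal3 Q' (a , out x a) (b , out x b) (c , out w c)) e (bc-≐ {Q'} t231 (out-square x (perm3 (≢-sym ac , ab , ≢-sym bc))))
  ... | _ | inj₂ (inj₁ refl) = subst (λ w → Bal3 Q' (a , out w a) (b , out y b) (c , out y c)) (swap₁₃ e) (out-square y π)
  ... | ab , bc , ac | inj₂ (inj₂ refl) =
    subst (λ w → Bal3 Q' (a , out x a) (b , out w b) (c , out x c)) (swap₂₃ e) (bc-≐ {Q'} t213 (out-square x (perm3 (≢-sym ab , ac , bc))))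

  out-injective : ∀ q g h → out g q ≡ out h q → g ≡ h
  out-injective q g h e with q ≟P p
  ... | yes refl = out-p-injective g h e
  ... | no qp = cancelˡ u g h (trans (rightDividesˡ g g) (sym (trans (cong (_∙ h) u≡u') (rightDividesˡ h g))))
    where
    open AS.IsQuasigroup (isQuasigroup Q) using (rightDividesˡ)
    open QuasigroupFacts Q using (cancelˡ)
    u u' : C
    u = _//_ Q g g
    u' = _//_ Q g h
    π : Perm3 p q (third p q)
    π = third-perm (≢-sym qp)
    ρ : Perm3 q (third p q) p
    ρ = perm3 (proj₁ (proj₂ (perm3-distinct π)) , ≢-sym (proj₂ (proj₂ (perm3-distinct π))) , ≢-sym (proj₁ (perm3-distinct π)))
    u≡u' : u ≡ u'
    u≡u' = out-p-injective u u'
      (trans (complete-unique ρ (bc-≐ {Q'} t231 (out-balanced π (rightDividesˡ g g))))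
             (trans (cong (λ v → complete q v (third p q) (out g (third p q))) e)
                    (sym (complete-unique ρ (bc-≐ {Q'} t231 (out-balanced π (rightDividesˡ h g)))))))

  ψ : Edge Q → Edge Q'
  ψ (q , h) = q , out h q

  ψ-inj : Injective _≡_ _≡_ ψ
  ψ-inj {q , g} {q' , h} e with cong proj₁ e
  ... | refl = cong (q ,_) (out-injective q g h (cong proj₂ e))

  balanced⇔ : ∀ g h k → (g ∙ h ≡ k → Bal3 Q' (ψ (e12 , g)) (ψ (e23 , h)) (ψ (e13 , k))) × (Bal3 Q' (ψ (e12 , g)) (ψ (e23 , h)) (ψ (e13 , k)) → g ∙ h ≡ k)
  balanced⇔ g h k = out-balanced p123 , λ B → sym (out-injective e13 k (g ∙ h)
    (trans (complete-unique p123 B) (sym (complete-unique p123 (out-balanced p123 refl)))))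

  monomorphism : BiasedGraphMono Q Q'
  monomorphism = M.φ , ψ , M.isMono
    where
    module M = EdgeMapMono Q Q' ψ ψ-inj (λ q → q) (λ e → e) (λ _ _ → refl) balanced⇔

proposition2p9 : (Q Q' : Quasigroup) (θ : L0Elem Q → L0Elem Q') →
    IsMatroidMono Q Q' θ →
    (CardGt2 Q → Σ (BiasedGraphMono Q Q') (λ θ'' → Induces Q Q' θ θ''))
    × (CardLe2 Q → BiasedGraphMono Q Q')
proposition2p9 Q Q' θ mono = induced-mono , some-mono
  where
  open MatroidMono Q Q' θ mono
  induced-mono : CardGt2 Q → Σ (BiasedGraphMono Q Q') (λ θ'' → Induces Q Q' θ θ'')
  induced-mono gt2@(a , _) = FixingE₀.induced (e₀-fixed gt2) a
  some-mono : CardLe2 Q → BiasedGraphMono Q Q'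
  some-mono le2 with θ nothing in θe₀
  ... | nothing = FixingE₀.normalised θe₀ le2
  ... | just (p , g') = ThroughLink.monomorphism Q Q' θ mono le2 p g' θe₀
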